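{- Let $\sigma$ and $\tau=a_1a_2\cdots a_n$ be permutations such that $\sigma$ has exactly one occurrence $i_1<i_2<\cdots<i_m$ in $\tau$ (as a quasi-consecutive pattern). Suppose that this occurrence is not consecutive (i.e. $i_2\neq i_1+1$) and that it uses none of the positions $1$, $2$, $n$. Then $\mu(\sigma,\tau)=0$.
   Context: Permutations are written in one-line notation. For permutations $\sigma$ of length $m$ and $\tau=a_1a_2\cdots a_n$ of length $n$, an occurrence of $\sigma$ in $\tau$ (as a quasi-consecutive pattern) is a sequence of positions $1\le i_1<i_2<\cdots<i_m\le n$ such that $i_{j+1}=i_j+1$ for all $2\le j\le m-1$ and $a_{i_1}\cdots a_{i_m}$ is order-isomorphic to $\sigma$ (i.e. $a_{i_s}<a_{i_t}$ iff $\sigma_s<\sigma_t$); thus all entries of the occurrence are adjacent in $\tau$ except possibly the first and second. The occurrence uses position $p$ if $p\in\{i_1,\dots,i_m\}$. The quasi-consecutive pattern poset is the set of all finite permutations ordered by $\sigma\le\tau$ iff $\tau$ contains an occurrence of $\sigma$. $\mu$ is the Möbius function of this poset: $\mu(x,x)=1$ and $\mu(x,y)=-\sum_{x\le z<y}\mu(x,z)$ for $x<y$. -}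

module Defs where

open import Data.Bool using (Bool; true; false; _∧_; not; if_then_else_; T)
open import Data.Nat using (ℕ; zero; suc; _<ᵇ_; _≡ᵇ_)
open import Data.Bool.ListAction using (all; any)
open import Data.List using (List; []; _∷_; map; _++_; length; concatMap; filterᵇ; upTo; zip; foldr)
open import Data.Product using (_,_; _×_)
open import Data.Integer using (ℤ; -_; 0ℤ; 1ℤ; _+_)

-- Permutations in one-line notation are lists of naturals; a permutation of
-- length n is a list of n distinct values, all < n (i.e. values 0..n-1).
-- Positions are 0-based (position p here = position p+1 in the paper).

distinctB : List ℕ → Bool
distinctB []       = true
distinctB (x ∷ xs) = not (any (x ≡ᵇ_) xs) ∧ distinctB xs

isPermB : List ℕ → Bool
isPermB w = all (λ x → x <ᵇ length w) w ∧ distinctB w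

IsPerm : List ℕ → Set
IsPerm w = T (isPermB w)

-- entry of a list at a position (default 0 out of range; only used in range)
at : List ℕ → ℕ → ℕ
at []       _       = 0
at (x ∷ xs) zero    = x
at (x ∷ xs) (suc i) = at xs i

orderIsoB : List ℕ → List ℕ → Bool
orderIsoB a b = (length a ≡ᵇ length b) ∧
  all (λ { (x , y) → all (λ { (x' , y') → eqBool (x <ᵇ x') (y <ᵇ y') }) ps }) ps
  where
    ps = zip a b
    eqBool : Bool → Bool → Bool
    eqBool true  c = c
    eqBool false c = not c

increasingB : List ℕ → Bool
increasingB (i ∷ j ∷ r) = (i <ᵇ j) ∧ increasingB (j ∷ r)
increasingB _           = true

consecutiveB : List ℕ → Bool
consecutiveB (i ∷ j ∷ r) = (j ≡ᵇ suc i) ∧ consecutiveB (j ∷ r)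
consecutiveB _           = true

quasiConsecutiveB : List ℕ → Bool
quasiConsecutiveB (i ∷ r) = consecutiveB r
quasiConsecutiveB []      = true

isOccB : List ℕ → List ℕ → List ℕ → Bool
isOccB σ τ is = (length is ≡ᵇ length σ) ∧ increasingB is
  ∧ all (λ i → i <ᵇ length τ) is ∧ quasiConsecutiveB is
  ∧ orderIsoB σ (map (at τ) is)

IsOcc : List ℕ → List ℕ → List ℕ → Set
IsOcc σ τ is = T (isOccB σ τ is)

subseqs : List ℕ → List (List ℕ)
subseqs []       = [] ∷ []
subseqs (x ∷ xs) = map (x ∷_) (subseqs xs) ++ subseqs xs

containsB : List ℕ → List ℕ → Bool
containsB σ τ = any (isOccB σ τ) (subseqs (upTo (length τ)))

listEqB : List ℕ → List ℕ → Bool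
listEqB []       []       = true
listEqB (x ∷ xs) (y ∷ ys) = (x ≡ᵇ y) ∧ listEqB xs ys
listEqB _        _        = false

words : ℕ → ℕ → List (List ℕ)
words k zero    = [] ∷ []
words k (suc l) = concatMap (λ w → map (_∷ w) (upTo k)) (words k l)

perms : ℕ → List (List ℕ)
perms k = filterᵇ isPermB (words k k)

sumℤ : List ℤ → ℤ
sumℤ = foldr _+_ 0ℤ

-- Every z with σ ≤ z ≤ τ has length ≤ length τ,
-- so the sum ranges over all permutations z of length ≤ |τ| with
-- σ ≤ z, z ≤ τ, z ≠ τ.  Fuel |τ|+1 suffices since a strict z < τ is shorter.
mobiusF : ℕ → List ℕ → List ℕ → ℤ
mobiusF zero    x y = 0ℤ
mobiusF (suc f) x y =
  if listEqB x y then 1ℤ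
  else if containsB x y then
    - sumℤ (map (mobiusF f x)
              (filterᵇ (λ z → containsB x z ∧ containsB z y ∧ not (listEqB z y))
                       (concatMap perms (upTo (suc (length y))))))
  else 0ℤ

-- μ(σ,τ) (defined as 0 when σ ≰ τ)
μ : List ℕ → List ℕ → ℤ
μ σ τ = mobiusF (suc (length τ)) σ τ

data NotConsecutive : List ℕ → Set where
  notConsec : ∀ {i j r} → T (not (j ≡ᵇ suc i)) → NotConsecutive (i ∷ j ∷ r)

-- Write the occurrence (0-based) as i, c+1, …, c+M with 0 < i < c and
-- c+M+1 < |τ|.  Extending its block by one position to the left, to the right, or on
-- both sides yields patterns ρ₁, ρ₂, ρ₁₂ of τ.  Every occurrence of a w with σ < w ≤ τ
-- must pass through the unique occurrence of σ, which forces ρ₁ ≤ w or ρ₂ ≤ w; and if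
-- ρ₁ ≠ ρ₂, a w ≤ τ above both is above ρ₁₂.  So (σ, τ] = [ρ₁, τ] ∪ [ρ₂, τ] with
-- intersection [ρ₁₂, τ].  The dual Möbius function μ↑(x) = μ(x, τ) sums to zero over
-- every interval [ρ, τ] with ρ < τ, so inclusion–exclusion gives μ(σ, τ) = μ↑(σ) = 0.
module Submission where

open import Defs
open import Data.Bool using (Bool; true; false; _∧_; _∨_; not; if_then_else_; T)
open import Data.Bool.ListAction using (all; any)
open import Data.Bool.Properties using (∧-assoc; T-≡)
open import Data.Empty using (⊥; ⊥-elim)
open import Data.Fin using (Fin; toℕ; fromℕ<)
open import Data.Fin.Properties using (pigeonhole; toℕ<n; toℕ-fromℕ<)
open import Data.Integer using (ℤ; 0ℤ; 1ℤ; -_) renaming (_+_ to _+ᶻ_; _*_ to _*ᶻ_)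
import Data.Integer.Properties as ℤ
open import Algebra.Properties.CommutativeSemigroup ℤ.+-commutativeSemigroup
  using () renaming (interchange to +-interchange)
open import Data.List using (List; []; _∷_; map; _++_; length; zip; applyUpTo; upTo; concatMap; filterᵇ)
open import Data.List.Properties using (length-map; map-∘; concatMap-++)
open import Data.List.Membership.Propositional using (_∈_; _∉_)
open import Data.List.Membership.Propositional.Properties using (∈-++⁺ˡ; ∈-++⁺ʳ; ∈-map⁺; ∈-map⁻; ∈-concat⁻′)
open import Data.List.Relation.Unary.Any using (here; there)
open import Data.Nat
  using (ℕ; zero; suc; pred; _+_; _∸_; _<ᵇ_; _≡ᵇ_; _≤_; _<_; z≤n; s≤s; s<s; s≤s⁻¹; _≟_; _≤?_)
open import Data.List.Membership.DecPropositional _≟_ using (_∈?_)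
open import Data.Nat.ListAction using (sum)
open import Data.Nat.Properties
  using (≡ᵇ⇒≡; ≡⇒≡ᵇ; <ᵇ⇒<; <⇒<ᵇ; ≤-refl; ≤-trans; <-trans; <-≤-trans; ≤-<-trans; n<1+n; n≤1+n; <⇒≤;
         <-irrefl; <-cmp; <⇒≱; ≮⇒≥; ≰⇒>; ≤-antisym; ≤∧≢⇒<; m≤n⇒m≤1+n; m≤n⇒m<n∨m≡n; suc-injective; pred-mono-≤;
         +-suc; +-assoc; +-comm; +-identityʳ; m≤m+n; m≤n+m; m+[n∸m]≡n; +-monoʳ-≤; +-monoˡ-≤; +-cancelˡ-≤;
         +-cancelʳ-≤; +-cancelʳ-<; ∸-monoˡ-<; ∸-monoʳ-<)
open import Data.Product using (Σ; ∃₂; ∃-syntax; _×_; _,_; proj₁; proj₂)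
open import Data.Sum using (_⊎_; inj₁; inj₂; [_,_]′)
open import Data.Unit using (⊤; tt)
open import Function using (id)
open import Function.Bundles using (Equivalence)
open import Relation.Binary.Definitions using (tri<; tri≈; tri>)
open import Relation.Binary.PropositionalEquality
  using (_≡_; _≢_; refl; sym; trans; cong; cong₂; subst; subst₂; module ≡-Reasoning)
open import Relation.Nullary using (yes; no)

∧-projˡ : ∀ {a b} → a ∧ b ≡ true → a ≡ true
∧-projˡ {true} {true} refl = refl

∧-projʳ : ∀ {a b} → a ∧ b ≡ true → b ≡ true
∧-projʳ {true} {true} refl = refl

∧-intro : ∀ {a b} → a ≡ true → b ≡ true → a ∧ b ≡ true
∧-intro refl refl = refl

∧-false : ∀ {a b} → a ∧ b ≡ false → a ≡ false ⊎ b ≡ false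
∧-false {false} _ = inj₁ refl
∧-false {true} {false} _ = inj₂ refl

not-true : ∀ {b} → not b ≡ true → b ≡ false
not-true {false} refl = refl

not-intro : ∀ {b} → b ≡ false → not b ≡ true
not-intro refl = refl

true≢false : ∀ {b} → b ≡ true → b ≡ false → ⊥
true≢false refl ()

bool-ext : ∀ {a b : Bool} → (a ≡ true → b ≡ true) → (b ≡ true → a ≡ true) → a ≡ b
bool-ext {false} {false} _ _ = refl
bool-ext {false} {true}  _ g with g refl
... | ()
bool-ext {true}  {false} f _ with f refl
... | ()
bool-ext {true}  {true}  _ _ = refl

bool-cases : ∀ (b : Bool) → b ≡ true ⊎ b ≡ false
bool-cases true  = inj₁ refl
bool-cases false = inj₂ refl

∨₃-ext : ∀ {s e a b} → (s ≡ true → e ≡ true ⊎ a ≡ true ⊎ b ≡ true) →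
         (e ≡ true → s ≡ true) → (a ≡ true → s ≡ true) → (b ≡ true → s ≡ true) → s ≡ e ∨ (a ∨ b)
∨₃-ext {false} {true}                 _ fe _  _  = fe refl
∨₃-ext {false} {false} {true}         _ _  fa _  = fa refl
∨₃-ext {false} {false} {false} {true} _ _  _  fb = fb refl
∨₃-ext {false} {false} {false} {false} _ _ _  _  = refl
∨₃-ext {true}  {true}                 _ _  _  _  = refl
∨₃-ext {true}  {false} {true}         _ _  _  _  = refl
∨₃-ext {true}  {false} {false} {true} _ _  _  _  = refl
∨₃-ext {true}  {false} {false} {false} to _ _ _ with to refl
... | inj₁ ()
... | inj₂ (inj₁ ())
... | inj₂ (inj₂ ())

<ᵇ-sound : ∀ {m n} → (m <ᵇ n) ≡ true → m < n
<ᵇ-sound {m} {n} h = <ᵇ⇒< m n (subst T (sym h) tt)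

<ᵇ-complete : ∀ {m n} → m < n → (m <ᵇ n) ≡ true
<ᵇ-complete {m} {n} h with m <ᵇ n | <⇒<ᵇ h
... | true | _ = refl

<ᵇ-false-sound : ∀ {m n} → (m <ᵇ n) ≡ false → n ≤ m
<ᵇ-false-sound h = ≮⇒≥ (λ lt → true≢false (<ᵇ-complete lt) h)

<ᵇ-false-complete : ∀ {m n} → n ≤ m → (m <ᵇ n) ≡ false
<ᵇ-false-complete {m} {n} h with m <ᵇ n in eq
... | false = refl
... | true  = ⊥-elim (<⇒≱ (<ᵇ-sound eq) h)

≡ᵇ-sound : ∀ {m n} → (m ≡ᵇ n) ≡ true → m ≡ n
≡ᵇ-sound {m} {n} h = ≡ᵇ⇒≡ m n (subst T (sym h) tt)

≡ᵇ-complete : ∀ {m n} → m ≡ n → (m ≡ᵇ n) ≡ true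
≡ᵇ-complete {m} {n} h with m ≡ᵇ n | ≡⇒≡ᵇ m n h
... | true | _ = refl

≡ᵇ-false-complete : ∀ {m n} → m ≢ n → (m ≡ᵇ n) ≡ false
≡ᵇ-false-complete {m} {n} h with m ≡ᵇ n in eq
... | false = refl
... | true  = ⊥-elim (h (≡ᵇ-sound eq))

all-sound : ∀ {A : Set} (P : A → Bool) (l : List A) → all P l ≡ true → ∀ {x} → x ∈ l → P x ≡ true
all-sound P (y ∷ l) h (here refl) = ∧-projˡ h
all-sound P (y ∷ l) h (there m)   = all-sound P l (∧-projʳ h) m

all-complete : ∀ {A : Set} (P : A → Bool) (l : List A) → (∀ {x} → x ∈ l → P x ≡ true) → all P l ≡ true
all-complete P []      f = refl
all-complete P (y ∷ l) f = ∧-intro (f (here refl)) (all-complete P l (λ m → f (there m)))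

all-false : ∀ {A : Set} (P : A → Bool) (l : List A) → all P l ≡ false → ∃[ x ] (x ∈ l × P x ≡ false)
all-false P (y ∷ l) h with P y in eq
... | false = y , here refl , eq
... | true with all-false P l h
... | x , m , p = x , there m , p

any-sound : ∀ {A : Set} (P : A → Bool) (l : List A) → any P l ≡ true → ∃[ x ] (x ∈ l × P x ≡ true)
any-sound P (y ∷ l) h with P y in eq
... | true  = y , here refl , eq
... | false with any-sound P l h
... | x , m , p = x , there m , p

any-complete : ∀ {A : Set} (P : A → Bool) (l : List A) {x} → x ∈ l → P x ≡ true → any P l ≡ true
any-complete P (y ∷ l) (here refl) p rewrite p = refl
any-complete P (y ∷ l) (there m) p with P y
... | true  = refl
... | false = any-complete P l m p

any-false : ∀ {A : Set} (P : A → Bool) (l : List A) → any P l ≡ false → ∀ {x} → x ∈ l → P x ≡ false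
any-false P l h {x} m with P x in eq
... | false = refl
... | true  = ⊥-elim (true≢false (any-complete P l m eq) h)

any-false-complete : ∀ {A : Set} (P : A → Bool) (l : List A) → (∀ {x} → x ∈ l → P x ≡ false) → any P l ≡ false
any-false-complete P []      f = refl
any-false-complete P (y ∷ l) f rewrite f (here refl) = any-false-complete P l (λ m → f (there m))

listEqB-sound : ∀ {x y} → listEqB x y ≡ true → x ≡ y
listEqB-sound {[]}    {[]}    h = refl
listEqB-sound {a ∷ x} {b ∷ y} h = cong₂ _∷_ (≡ᵇ-sound (∧-projˡ h)) (listEqB-sound (∧-projʳ h))

listEqB-refl : ∀ x → listEqB x x ≡ true
listEqB-refl []      = refl
listEqB-refl (a ∷ x) = ∧-intro (≡ᵇ-complete {a} refl) (listEqB-refl x)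

listEqB-false-sound : ∀ {x y} → listEqB x y ≡ false → x ≢ y
listEqB-false-sound {x} h refl = true≢false (listEqB-refl x) h

listEqB-false-complete : ∀ {x y} → x ≢ y → listEqB x y ≡ false
listEqB-false-complete {x} {y} h with listEqB x y in eq
... | false = refl
... | true  = ⊥-elim (h (listEqB-sound eq))

at-map : ∀ (f : ℕ → ℕ) (l : List ℕ) i → i < length l → at (map f l) i ≡ f (at l i)
at-map f (x ∷ l) zero    _       = refl
at-map f (x ∷ l) (suc i) (s<s h) = at-map f l i h

at-∈ : ∀ (l : List ℕ) i → i < length l → at l i ∈ l
at-∈ (x ∷ l) zero    _       = here refl
at-∈ (x ∷ l) (suc i) (s<s h) = there (at-∈ l i h)

∈-at : ∀ (l : List ℕ) {x} → x ∈ l → ∃[ i ] (i < length l × at l i ≡ x)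
∈-at (y ∷ l) (here refl) = zero , s≤s z≤n , refl
∈-at (y ∷ l) (there m) with ∈-at l m
... | i , h , e = suc i , s≤s h , e

at-ext : ∀ (l l' : List ℕ) → length l ≡ length l' → (∀ i → i < length l → at l i ≡ at l' i) → l ≡ l'
at-ext []      []       _ _ = refl
at-ext (x ∷ l) (y ∷ l') e f =
  cong₂ _∷_ (f zero (s≤s z≤n)) (at-ext l l' (suc-injective e) (λ i h → f (suc i) (s≤s h)))

map-cong-at : ∀ (f g : ℕ → ℕ) (l : List ℕ) → (∀ i → i < length l → f (at l i) ≡ g (at l i)) → map f l ≡ map g l
map-cong-at f g []      _ = refl
map-cong-at f g (x ∷ l) h = cong₂ _∷_ (h zero (s≤s z≤n)) (map-cong-at f g l (λ i p → h (suc i) (s≤s p)))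

interval : ℕ → ℕ → List ℕ
interval a zero    = []
interval a (suc n) = a ∷ interval (suc a) n

upTo-interval : ∀ n → upTo n ≡ interval 0 n
upTo-interval n = go 0 n (λ i → i) (λ _ → refl)
  where
  go : ∀ a n (f : ℕ → ℕ) → (∀ i → f i ≡ a + i) → applyUpTo f n ≡ interval a n
  go a zero    f e = refl
  go a (suc n) f e = cong₂ _∷_ (trans (e 0) (+-identityʳ a))
                       (go (suc a) n (λ i → f (suc i)) (λ i → trans (e (suc i)) (+-suc a i)))

interval-++ : ∀ a m n → interval a (m + n) ≡ interval a m ++ interval (a + m) n
interval-++ a zero    n rewrite +-identityʳ a = refl
interval-++ a (suc m) n rewrite +-suc a m = cong (a ∷_) (interval-++ (suc a) m n)

length-interval : ∀ a n → length (interval a n) ≡ n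
length-interval a zero    = refl
length-interval a (suc n) = cong suc (length-interval (suc a) n)

at-interval : ∀ a n i → i < n → at (interval a n) i ≡ a + i
at-interval a (suc n) zero    _       = sym (+-identityʳ a)
at-interval a (suc n) (suc i) (s<s h) = trans (at-interval (suc a) n i h) (sym (+-suc a i))

∈-interval : ∀ a n {x} → x ∈ interval a n → a ≤ x × x < a + n
∈-interval a (suc n) (here refl) = ≤-refl , subst (a <_) (sym (+-suc a n)) (s≤s (m≤m+n a n))
∈-interval a (suc n) {x} (there m) with ∈-interval (suc a) n m
... | lo , hi = <⇒≤ lo , subst (x <_) (sym (+-suc a n)) hi

interval-injective : ∀ a b n → 0 < n → interval a n ≡ interval b n → a ≡ b
interval-injective a b (suc n) _ e = cong head e
  where
  head : List ℕ → ℕ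
  head []      = 0
  head (x ∷ _) = x

record OrderIso (a b : List ℕ) : Set where
  constructor mkIso
  field
    iso-length : length a ≡ length b
    iso-order  : ∀ i j → i < length a → j < length a → (at a i <ᵇ at a j) ≡ (at b i <ᵇ at b j)
open OrderIso public

Increasing : List ℕ → Set
Increasing l = ∀ t → suc t < length l → at l t < at l (suc t)

Consecutive : List ℕ → Set
Consecutive l = ∀ t → suc t < length l → at l (suc t) ≡ suc (at l t)

QuasiConsecutive : List ℕ → Set
QuasiConsecutive []      = ⊤
QuasiConsecutive (k ∷ r) = Consecutive r

Bounded : List ℕ → ℕ → Set
Bounded K n = ∀ t → t < length K → at K t < n

record Occurrence (x y K : List ℕ) : Set where
  constructor mkOcc
  field
    occ-length     : length K ≡ length x
    occ-increasing : Increasing K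
    occ-bounded    : Bounded K (length y)
    occ-quasi      : QuasiConsecutive K
    occ-iso        : OrderIso x (map (at y) K)
open Occurrence public

zip-at : ∀ (a b : List ℕ) i → i < length a → i < length b → (at a i , at b i) ∈ zip a b
zip-at (x ∷ a) (y ∷ b) zero    _        _        = here refl
zip-at (x ∷ a) (y ∷ b) (suc i) (s<s h₁) (s<s h₂) = there (zip-at a b i h₁ h₂)

∈-zip : ∀ (a b : List ℕ) {p} → p ∈ zip a b → ∃[ i ] (i < length a × i < length b × p ≡ (at a i , at b i))
∈-zip (x ∷ a) (y ∷ b) (here refl) = zero , s≤s z≤n , s≤s z≤n , refl
∈-zip (x ∷ a) (y ∷ b) (there m) with ∈-zip a b m
... | i , h₁ , h₂ , e = suc i , s≤s h₁ , s≤s h₂ , e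

orderIsoB-sound : ∀ a b → orderIsoB a b ≡ true → OrderIso a b
orderIsoB-sound a b h = mkIso same-length same-order
  where
  same-length : length a ≡ length b
  same-length = ≡ᵇ-sound (∧-projˡ h)
  inB : ∀ {i} → i < length a → i < length b
  inB {i} = subst (i <_) same-length
  same-order : ∀ i j → i < length a → j < length a → (at a i <ᵇ at a j) ≡ (at b i <ᵇ at b j)
  same-order i j hi hj
    with at a i <ᵇ at a j | at b i <ᵇ at b j
       | all-sound _ (zip a b) (all-sound _ (zip a b) (∧-projʳ h) (zip-at a b i hi (inB hi)))
                                (zip-at a b j hj (inB hj))
  ... | true  | true  | _ = refl
  ... | false | false | _ = refl
  ... | true  | false | ()
  ... | false | true  | ()

orderIsoB-complete : ∀ a b → OrderIso a b → orderIsoB a b ≡ true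
orderIsoB-complete a b (mkIso e f) with orderIsoB a b in eq
... | true  = refl
... | false with ∧-false eq
... | inj₁ h = ⊥-elim (true≢false (≡ᵇ-complete e) h)
... | inj₂ h with all-false _ (zip a b) h
... | p , m , hp with ∈-zip a b m
... | i , hi , _ , refl with all-false _ (zip a b) hp
... | p' , m' , hp' with ∈-zip a b m'
... | j , hj , _ , refl with at a i <ᵇ at a j | at b i <ᵇ at b j | hp' | f i j hi hj
... | true  | true  | () | _
... | false | false | () | _

increasingB-sound : ∀ l → increasingB l ≡ true → Increasing l
increasingB-sound (i ∷ j ∷ r) h zero    _       = <ᵇ-sound (∧-projˡ h)
increasingB-sound (i ∷ j ∷ r) h (suc t) (s<s p) = increasingB-sound (j ∷ r) (∧-projʳ h) t p
increasingB-sound (i ∷ [])    h t       (s<s ())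

increasingB-complete : ∀ l → Increasing l → increasingB l ≡ true
increasingB-complete []          _ = refl
increasingB-complete (i ∷ [])    _ = refl
increasingB-complete (i ∷ j ∷ r) f =
  ∧-intro (<ᵇ-complete (f zero (s<s (s<s z≤n)))) (increasingB-complete (j ∷ r) (λ t p → f (suc t) (s<s p)))

consecutiveB-sound : ∀ l → consecutiveB l ≡ true → Consecutive l
consecutiveB-sound (i ∷ j ∷ r) h zero    _       = ≡ᵇ-sound (∧-projˡ h)
consecutiveB-sound (i ∷ j ∷ r) h (suc t) (s<s p) = consecutiveB-sound (j ∷ r) (∧-projʳ h) t p
consecutiveB-sound (i ∷ [])    h t       (s<s ())

consecutiveB-complete : ∀ l → Consecutive l → consecutiveB l ≡ true
consecutiveB-complete []          _ = refl
consecutiveB-complete (i ∷ [])    _ = refl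
consecutiveB-complete (i ∷ j ∷ r) f =
  ∧-intro (≡ᵇ-complete (f zero (s<s (s<s z≤n)))) (consecutiveB-complete (j ∷ r) (λ t p → f (suc t) (s<s p)))

quasiConsecutiveB-sound : ∀ l → quasiConsecutiveB l ≡ true → QuasiConsecutive l
quasiConsecutiveB-sound []      _ = tt
quasiConsecutiveB-sound (k ∷ r) h = consecutiveB-sound r h

quasiConsecutiveB-complete : ∀ l → QuasiConsecutive l → quasiConsecutiveB l ≡ true
quasiConsecutiveB-complete []      _ = refl
quasiConsecutiveB-complete (k ∷ r) h = consecutiveB-complete r h

boundedB-sound : ∀ K n → all (λ i → i <ᵇ n) K ≡ true → Bounded K n
boundedB-sound K n h t p = <ᵇ-sound (all-sound (λ i → i <ᵇ n) K h (at-∈ K t p))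

boundedB-complete : ∀ K n → Bounded K n → all (λ i → i <ᵇ n) K ≡ true
boundedB-complete K n f = all-complete (λ i → i <ᵇ n) K entry
  where
  entry : ∀ {x} → x ∈ K → (x <ᵇ n) ≡ true
  entry m with ∈-at K m
  ... | t , p , refl = <ᵇ-complete (f t p)

isOccB-sound : ∀ x y K → isOccB x y K ≡ true → Occurrence x y K
isOccB-sound x y K h
  with length K ≡ᵇ length x in e₁ | increasingB K in e₂ | all (λ i → i <ᵇ length y) K in e₃
     | quasiConsecutiveB K in e₄ | orderIsoB x (map (at y) K) in e₅
... | true | true | true | true | true =
  mkOcc (≡ᵇ-sound e₁) (increasingB-sound K e₂) (boundedB-sound K (length y) e₃)
        (quasiConsecutiveB-sound K e₄) (orderIsoB-sound x (map (at y) K) e₅)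
... | false | _     | _     | _     | _     = ⊥-elim (true≢false h refl)
... | true  | false | _     | _     | _     = ⊥-elim (true≢false h refl)
... | true  | true  | false | _     | _     = ⊥-elim (true≢false h refl)
... | true  | true  | true  | false | _     = ⊥-elim (true≢false h refl)
... | true  | true  | true  | true  | false = ⊥-elim (true≢false h refl)

isOccB-complete : ∀ x y K → Occurrence x y K → isOccB x y K ≡ true
isOccB-complete x y K (mkOcc a b c d e) =
  ∧-intro (≡ᵇ-complete a) (∧-intro (increasingB-complete K b) (∧-intro (boundedB-complete K (length y) c)
    (∧-intro (quasiConsecutiveB-complete K d) (orderIsoB-complete x (map (at y) K) e))))

increasing-tail : ∀ k K → Increasing (k ∷ K) → Increasing K
increasing-tail k K f t h = f (suc t) (s<s h)

increasing-mono : ∀ l → Increasing l → ∀ i j → i < j → j < length l → at l i < at l j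
increasing-mono l f i (suc j) (s≤s i≤j) hj with i ≟ j
... | yes refl = f i hj
... | no  i≢j  = <-trans (increasing-mono l f i j (≤∧≢⇒< i≤j i≢j) (<-trans (n<1+n j) hj)) (f j hj)

increasing-mono-≤ : ∀ l → Increasing l → ∀ i j → i ≤ j → j < length l → at l i ≤ at l j
increasing-mono-≤ l f i j h hj with i ≟ j
... | yes refl = ≤-refl
... | no  i≢j  = <⇒≤ (increasing-mono l f i j (≤∧≢⇒< h i≢j) hj)

increasing-injective : ∀ l → Increasing l → ∀ i j → i < length l → j < length l → at l i ≡ at l j → i ≡ j
increasing-injective l f i j hi hj e with <-cmp i j
... | tri< i<j _ _ = ⊥-elim (<-irrefl e (increasing-mono l f i j i<j hj))
... | tri≈ _ i≡j _ = i≡j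
... | tri> _ _ j<i = ⊥-elim (<-irrefl (sym e) (increasing-mono l f j i j<i hi))

increasing-≥-index : ∀ K → Increasing K → ∀ t → t < length K → t ≤ at K t
increasing-≥-index K f zero    _ = z≤n
increasing-≥-index K f (suc t) h = ≤-trans (s≤s (increasing-≥-index K f t (<-trans (n<1+n t) h))) (f t h)

OrderIso-refl : ∀ a → OrderIso a a
OrderIso-refl a = mkIso refl (λ _ _ _ _ → refl)

OrderIso-sym : ∀ {a b} → OrderIso a b → OrderIso b a
OrderIso-sym (mkIso e f) = mkIso (sym e) (λ i j hi hj → sym (f i j (subst (i <_) (sym e) hi) (subst (j <_) (sym e) hj)))

OrderIso-trans : ∀ {a b c} → OrderIso a b → OrderIso b c → OrderIso a c
OrderIso-trans (mkIso e f) (mkIso e' g) =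
  mkIso (trans e e') (λ i j hi hj → trans (f i j hi hj) (g i j (subst (i <_) e hi) (subst (j <_) e hj)))

OrderIso-select : ∀ (u v K : List ℕ) → OrderIso u v → Bounded K (length u) → OrderIso (map (at u) K) (map (at v) K)
OrderIso-select u v K (mkIso e f) b = mkIso (trans (length-map (at u) K) (sym (length-map (at v) K))) same-order
  where
  same-order : ∀ i j → i < length (map (at u) K) → j < length (map (at u) K) →
               (at (map (at u) K) i <ᵇ at (map (at u) K) j) ≡ (at (map (at v) K) i <ᵇ at (map (at v) K) j)
  same-order i j hi hj
    rewrite length-map (at u) K | at-map (at u) K i hi | at-map (at u) K j hj
          | at-map (at v) K i hi | at-map (at v) K j hj = f (at K i) (at K j) (b i hi) (b j hj)

select-∘ : ∀ (z J K : List ℕ) → Bounded K (length J) → map (at z) (map (at J) K) ≡ map (at (map (at z) J)) K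
select-∘ z J K b = trans (sym (map-∘ K)) (map-cong-at _ _ K (λ i h → sym (at-map (at z) J (at K i) (b i h))))

∘-increasing : ∀ J K → Increasing J → Increasing K → Bounded K (length J) → Increasing (map (at J) K)
∘-increasing J K fJ fK b t h
  rewrite length-map (at J) K | at-map (at J) K t (<-trans (n<1+n t) h) | at-map (at J) K (suc t) h =
  increasing-mono J fJ (at K t) (at K (suc t)) (fK t h) (b (suc t) h)

∘-bounded : ∀ J K n → Bounded J n → Bounded K (length J) → Bounded (map (at J) K) n
∘-bounded J K n bJ bK t h rewrite length-map (at J) K | at-map (at J) K t h = bJ (at K t) (bK t h)

-- all positions of K but the first are ≥ 1, hence land in the consecutive tail of J
∘-quasi : ∀ J K → Increasing K → QuasiConsecutive J → QuasiConsecutive K → Bounded K (length J) →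
          QuasiConsecutive (map (at J) K)
∘-quasi J       []      fK qJ qK b = tt
∘-quasi []      (k ∷ r) fK qJ qK b = ⊥-elim (<-irrefl refl (≤-<-trans z≤n (b zero (s≤s z≤n))))
∘-quasi (j ∷ J) (k ∷ r) fK qJ qK b t h
  rewrite length-map (at (j ∷ J)) r | at-map (at (j ∷ J)) r t (<-trans (n<1+n t) h)
        | at-map (at (j ∷ J)) r (suc t) h | qK t h = step (at r t) refl
  where
  positive : 0 < at r t
  positive = <-≤-trans (≤-<-trans z≤n (fK zero (s≤s (≤-<-trans z≤n h))))
                       (increasing-mono-≤ (k ∷ r) fK 1 (suc t) (s≤s z≤n) (s<s (<-trans (n<1+n t) h)))
  inJ : suc (at r t) < suc (length J)
  inJ = subst (_< suc (length J)) (qK t h) (b (suc (suc t)) (s<s h))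
  step : ∀ s → s ≡ at r t → at (j ∷ J) (suc s) ≡ suc (at (j ∷ J) s)
  step zero    e = ⊥-elim (<-irrefl e positive)
  step (suc s) e = qJ s (s≤s⁻¹ (subst (λ v → suc v < suc (length J)) (sym e) inJ))

occurrence-∘ : ∀ x y z K J → Occurrence x y K → Occurrence y z J → Occurrence x z (map (at J) K)
occurrence-∘ x y z K J oK oJ =
  mkOcc (trans (length-map (at J) K) (occ-length oK))
        (∘-increasing J K (occ-increasing oJ) (occ-increasing oK) bK)
        (∘-bounded J K (length z) (occ-bounded oJ) bK)
        (∘-quasi J K (occ-increasing oK) (occ-quasi oJ) (occ-quasi oK) bK)
        (subst (OrderIso x) (sym (select-∘ z J K bK))
               (OrderIso-trans (occ-iso oK) (OrderIso-select y (map (at z) J) K (occ-iso oJ) (occ-bounded oK))))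
  where
  bK : Bounded K (length J)
  bK = subst (Bounded K) (sym (occ-length oJ)) (occ-bounded oK)

occurrence-pullback : ∀ x w τ J K → Occurrence w τ J → length K ≡ length x → Increasing K →
                      QuasiConsecutive K → Bounded K (length J) → OrderIso x (map (at τ) (map (at J) K)) →
                      Occurrence x w K
occurrence-pullback x w τ J K oJ e fK qK bK iso =
  mkOcc e fK bK' qK
    (OrderIso-trans (subst (OrderIso x) (select-∘ τ J K bK) iso)
                    (OrderIso-sym (OrderIso-select w (map (at τ) J) K (occ-iso oJ) bK')))
  where
  bK' : Bounded K (length w)
  bK' = subst (Bounded K) (occ-length oJ) bK

subseqs-interval : ∀ n a K → Increasing K → (∀ t → t < length K → a ≤ at K t × at K t < a + n) →
                   K ∈ subseqs (interval a n)
subseqs-interval zero a [] _ _ = here refl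
subseqs-interval zero a (k ∷ K) _ g with g zero (s≤s z≤n)
... | lo , hi = ⊥-elim (<-irrefl refl (≤-<-trans lo (subst (k <_) (+-identityʳ a) hi)))
subseqs-interval (suc n) a [] _ _ =
  ∈-++⁺ʳ (map (a ∷_) (subseqs (interval (suc a) n))) (subseqs-interval n (suc a) [] (λ _ ()) (λ _ ()))
subseqs-interval (suc n) a (k ∷ K) f g with a ≟ k
... | yes refl = ∈-++⁺ˡ (∈-map⁺ (a ∷_) (subseqs-interval n (suc a) K (increasing-tail k K f) inTail))
  where
  inTail : ∀ t → t < length K → suc a ≤ at K t × at K t < suc a + n
  inTail t h = ≤-trans (f zero (s<s (≤-<-trans z≤n h))) (increasing-mono-≤ K (increasing-tail k K f) 0 t z≤n h)
             , subst (at K t <_) (+-suc a n) (proj₂ (g (suc t) (s<s h)))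
... | no a≢k = ∈-++⁺ʳ (map (a ∷_) (subseqs (interval (suc a) n))) (subseqs-interval n (suc a) (k ∷ K) f inRest)
  where
  a<k : a < k
  a<k = ≤∧≢⇒< (proj₁ (g zero (s≤s z≤n))) a≢k
  inRest : ∀ t → t < length (k ∷ K) → suc a ≤ at (k ∷ K) t × at (k ∷ K) t < suc a + n
  inRest t h = <-≤-trans a<k (increasing-mono-≤ (k ∷ K) f 0 t z≤n h)
             , subst (at (k ∷ K) t <_) (+-suc a n) (proj₂ (g t h))

containsB-sound : ∀ x y → containsB x y ≡ true → ∃[ K ] Occurrence x y K
containsB-sound x y h with any-sound (isOccB x y) (subseqs (upTo (length y))) h
... | K , _ , p = K , isOccB-sound x y K p

containsB-complete : ∀ x y K → Occurrence x y K → containsB x y ≡ true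
containsB-complete x y K o = any-complete (isOccB x y) (subseqs (upTo (length y))) listed (isOccB-complete x y K o)
  where
  listed : K ∈ subseqs (upTo (length y))
  listed rewrite upTo-interval (length y) =
    subseqs-interval (length y) 0 K (occ-increasing o) (λ t h → z≤n , occ-bounded o t h)

contains-trans : ∀ x y z → containsB x y ≡ true → containsB y z ≡ true → containsB x z ≡ true
contains-trans x y z h₁ h₂ with containsB-sound x y h₁ | containsB-sound y z h₂
... | K , oK | J , oJ = containsB-complete x z (map (at J) K) (occurrence-∘ x y z K J oK oJ)

interval-increasing : ∀ a n → Increasing (interval a n)
interval-increasing a n t h
  rewrite length-interval a n | at-interval a n t (<-trans (n<1+n t) h) | at-interval a n (suc t) h | +-suc a t =
  n<1+n _

interval-consecutive : ∀ a n → Consecutive (interval a n)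
interval-consecutive a n t h
  rewrite length-interval a n | at-interval a n t (<-trans (n<1+n t) h) | at-interval a n (suc t) h | +-suc a t =
  refl

contains-refl : ∀ x → containsB x x ≡ true
contains-refl x = containsB-complete x x (interval 0 n) (mkOcc (length-interval 0 n) (interval-increasing 0 n) bounded quasi iso)
  where
  n = length x
  inRange : ∀ {t} → t < length (interval 0 n) → t < n
  inRange {t} = subst (t <_) (length-interval 0 n)
  bounded : Bounded (interval 0 n) n
  bounded t h = subst (_< n) (sym (at-interval 0 n t (inRange h))) (inRange h)
  quasi : QuasiConsecutive (interval 0 n)
  quasi with n
  ... | zero  = tt
  ... | suc m = interval-consecutive 1 m
  iso : OrderIso x (map (at x) (interval 0 n))
  iso = subst (OrderIso x) (sym (at-ext _ x (trans (length-map (at x) (interval 0 n)) (length-interval 0 n)) entry))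
              (OrderIso-refl x)
    where
    entry : ∀ i → i < length (map (at x) (interval 0 n)) → at (map (at x) (interval 0 n)) i ≡ at x i
    entry i h = let h' = subst (i <_) (length-map (at x) (interval 0 n)) h
                in trans (at-map (at x) (interval 0 n) i h') (cong (at x) (at-interval 0 n i (inRange h')))

occurrence-length : ∀ x y K → Occurrence x y K → length x ≤ length y
occurrence-length x y []      o = subst (_≤ length y) (occ-length o) z≤n
occurrence-length x y (k ∷ K) o =
  subst (_≤ length y) (occ-length o)
    (≤-trans (s≤s (increasing-≥-index (k ∷ K) (occ-increasing o) (length K) (n<1+n _)))
             (occ-bounded o (length K) (n<1+n _)))

contains-length : ∀ x y → containsB x y ≡ true → length x ≤ length y
contains-length x y h with containsB-sound x y h
... | K , o = occurrence-length x y K o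

Distinct : List ℕ → Set
Distinct l = ∀ i j → i < length l → j < length l → at l i ≡ at l j → i ≡ j

distinctB-sound : ∀ l → distinctB l ≡ true → Distinct l
distinctB-sound (x ∷ l) h zero    zero    _       _       _ = refl
distinctB-sound (x ∷ l) h zero    (suc j) _       (s<s hj) e =
  ⊥-elim (true≢false (≡ᵇ-complete e) (any-false (x ≡ᵇ_) l (not-true (∧-projˡ h)) (at-∈ l j hj)))
distinctB-sound (x ∷ l) h (suc i) zero    (s<s hi) _      e =
  ⊥-elim (true≢false (≡ᵇ-complete (sym e)) (any-false (x ≡ᵇ_) l (not-true (∧-projˡ h)) (at-∈ l i hi)))
distinctB-sound (x ∷ l) h (suc i) (suc j) (s<s hi) (s<s hj) e = cong suc (distinctB-sound l (∧-projʳ h) i j hi hj e)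

distinctB-complete : ∀ l → Distinct l → distinctB l ≡ true
distinctB-complete []      _ = refl
distinctB-complete (x ∷ l) d =
  ∧-intro (not-intro (any-false-complete (x ≡ᵇ_) l fresh))
          (distinctB-complete l (λ i j hi hj e → suc-injective (d (suc i) (suc j) (s<s hi) (s<s hj) e)))
  where
  fresh : ∀ {y} → y ∈ l → (x ≡ᵇ y) ≡ false
  fresh m with ∈-at l m
  ... | i , hi , refl = ≡ᵇ-false-complete (λ e → 0≢suc (d zero (suc i) (s≤s z≤n) (s<s hi) e))
    where
    0≢suc : ∀ {k} → 0 ≡ suc k → ⊥
    0≢suc ()

isPermB-sound : ∀ x → isPermB x ≡ true → Bounded x (length x) × Distinct x
isPermB-sound x h = boundedB-sound x (length x) (∧-projˡ h) , distinctB-sound x (∧-projʳ h)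

isPermB-complete : ∀ x → Bounded x (length x) → Distinct x → isPermB x ≡ true
isPermB-complete x b d = ∧-intro (boundedB-complete x (length x) b) (distinctB-complete x d)

distinct-length : ∀ l k → Distinct l → Bounded l k → length l ≤ k
distinct-length l k d b with length l ≤? k
... | yes l≤k = l≤k
... | no  l≰k = ⊥-elim (no-collision (pigeonhole (≰⇒> l≰k) entry))
  where
  entry : Fin (length l) → Fin k
  entry i = fromℕ< (b (toℕ i) (toℕ<n i))
  no-collision : ∃₂ (λ i j → toℕ i < toℕ j × entry i ≡ entry j) → ⊥
  no-collision (i , j , i<j , same) = <-irrefl (d (toℕ i) (toℕ j) (toℕ<n i) (toℕ<n j) sameEntry) i<j
    where
    sameEntry : at l (toℕ i) ≡ at l (toℕ j)
    sameEntry = trans (sym (toℕ-fromℕ< _)) (trans (cong toℕ same) (toℕ-fromℕ< _))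

perm-surjective : ∀ x → Bounded x (length x) → Distinct x → ∀ v → v < length x → ∃[ i ] (i < length x × at x i ≡ v)
perm-surjective x b d v hv with v ∈? x
... | yes v∈x = ∈-at x v∈x
... | no  v∉x = ⊥-elim (<-irrefl refl (distinct-length (v ∷ x) (length x) d' b'))
  where
  b' : Bounded (v ∷ x) (length x)
  b' zero    _       = hv
  b' (suc t) (s<s h) = b t h
  d' : Distinct (v ∷ x)
  d' zero    zero    _        _        _ = refl
  d' zero    (suc j) _        (s<s hj) e = ⊥-elim (v∉x (subst (_∈ x) (sym e) (at-∈ x j hj)))
  d' (suc i) zero    (s<s hi) _        e = ⊥-elim (v∉x (subst (_∈ x) e (at-∈ x i hi)))
  d' (suc i) (suc j) (s<s hi) (s<s hj) e = cong suc (d i j hi hj e)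

-- It suffices to show y ≤ x entrywise
-- (then swap the roles); this goes by induction on the value x[p]: if x[p] < y[p],
-- the value x[p] sits in y at some q with y[q] < y[p], so x[q] < x[p] and by
-- induction y[q] ≤ x[q] < x[p] = y[q], a contradiction.
module _ (x y : List ℕ) (px : Bounded x (length x) × Distinct x) (py : Bounded y (length y) × Distinct y)
         (iso : OrderIso x y) where

  private
    same-length = iso-length iso

  perm-iso-≤ : ∀ v p → p < length x → at x p < v → at y p ≤ at x p
  perm-iso-≤ (suc v) p hp hv with at y p ≤? at x p
  ... | yes le = le
  ... | no  gt with perm-surjective y (proj₁ py) (proj₂ py) (at x p) (subst (at x p <_) same-length (proj₁ px p hp))
  ...   | q , hq , yq≡xp = ⊥-elim (<-irrefl refl (≤-<-trans (subst (_≤ at x q) yq≡xp ih) xq<xp))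
    where
    hq' : q < length x
    hq' = subst (q <_) (sym same-length) hq
    xq<xp : at x q < at x p
    xq<xp = <ᵇ-sound (trans (iso-order iso q p hq' hp)
                            (<ᵇ-complete (subst (_< at y p) (sym yq≡xp) (≰⇒> gt))))
    ih : at y q ≤ at x q
    ih = perm-iso-≤ v q hq' (<-≤-trans xq<xp (s≤s⁻¹ hv))

perm-iso-≡ : ∀ x y → isPermB x ≡ true → isPermB y ≡ true → OrderIso x y → x ≡ y
perm-iso-≡ x y hx hy iso = at-ext x y (iso-length iso) entry
  where
  px = isPermB-sound x hx
  py = isPermB-sound y hy
  entry : ∀ p → p < length x → at x p ≡ at y p
  entry p hp = ≤-antisym (perm-iso-≤ y x py px (OrderIso-sym iso) (suc (at y p)) p hp' (n<1+n _))
                         (perm-iso-≤ x y px py iso (suc (at x p)) p hp (n<1+n _))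
    where
    hp' = subst (p <_) (iso-length iso) hp

increasing-full : ∀ K n → Increasing K → Bounded K n → length K ≡ n → ∀ t → t < n → at K t ≡ t
increasing-full K n f b refl t ht =
  ≤-antisym (s≤s⁻¹ (+-cancelʳ-< (n ∸ suc t) (at K t) (suc t) (subst (at K t + (n ∸ suc t) <_) (sym (m+[n∸m]≡n ht)) (room K f b t ht))))
            (increasing-≥-index K f t ht)
  where
  room : ∀ K → Increasing K → ∀ {n} → Bounded K n → ∀ t → t < length K → at K t + (length K ∸ suc t) < n
  room (k ∷ [])     f {n} b zero _ = subst (_< n) (sym (+-identityʳ k)) (b zero (s≤s z≤n))
  room (k ∷ k' ∷ K) f {n} b zero _ =
    ≤-<-trans (subst (_≤ k' + length K) (sym (+-suc k (length K))) (+-monoˡ-≤ (length K) (f zero (s≤s (s≤s z≤n)))))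
              (room (k' ∷ K) (increasing-tail k (k' ∷ K) f) (λ t h → b (suc t) (s<s h)) zero (s≤s z≤n))
  room (k ∷ K) f b (suc t) (s<s h) = room K (increasing-tail k K f) (λ t h → b (suc t) (s<s h)) t h

contains-antisym : ∀ x y → isPermB x ≡ true → isPermB y ≡ true → containsB x y ≡ true → length x ≡ length y → x ≡ y
contains-antisym x y hx hy h same with containsB-sound x y h
... | K , o = perm-iso-≡ x y hx hy (subst (OrderIso x) selectAll (occ-iso o))
  where
  lK : length K ≡ length y
  lK = trans (occ-length o) same
  full : ∀ t → t < length y → at K t ≡ t
  full = increasing-full K (length y) (occ-increasing o) (occ-bounded o) lK
  selectAll : map (at y) K ≡ y
  selectAll = at-ext (map (at y) K) y (trans (length-map (at y) K) lK) λ i h →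
    let h' = subst (i <_) (length-map (at y) K) h
    in trans (at-map (at y) K i h') (cong (at y) (full i (subst (i <_) lK h')))

count-below : ℕ → List ℕ → ℕ
count-below a []      = 0
count-below a (b ∷ v) = if b <ᵇ a then suc (count-below a v) else count-below a v

count-below-mono : ∀ a a' v → a ≤ a' → count-below a v ≤ count-below a' v
count-below-mono a a' []      h = z≤n
count-below-mono a a' (b ∷ v) h with b <ᵇ a in e₁ | b <ᵇ a' in e₂
... | true  | true  = s≤s (count-below-mono a a' v h)
... | false | false = count-below-mono a a' v h
... | false | true  = m≤n⇒m≤1+n (count-below-mono a a' v h)
... | true  | false = ⊥-elim (<-irrefl refl (<-≤-trans (<ᵇ-sound e₁) (≤-trans h (<ᵇ-false-sound e₂))))

count-below-strict : ∀ a a' v → a < a' → a ∈ v → count-below a v < count-below a' v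
count-below-strict a a' (b ∷ v) h (here refl)
  rewrite <ᵇ-false-complete {b} {b} ≤-refl | <ᵇ-complete {b} {a'} h = s≤s (count-below-mono b a' v (<⇒≤ h))
count-below-strict a a' (b ∷ v) h (there m) with b <ᵇ a in e₁ | b <ᵇ a' in e₂
... | true  | true  = s≤s (count-below-strict a a' v h m)
... | false | false = count-below-strict a a' v h m
... | false | true  = m≤n⇒m≤1+n (count-below-strict a a' v h m)
... | true  | false = ⊥-elim (<-irrefl refl (<-trans (<ᵇ-sound e₁) (<-≤-trans h (<ᵇ-false-sound e₂))))

count-below-≤ : ∀ a v → count-below a v ≤ length v
count-below-≤ a []      = z≤n
count-below-≤ a (b ∷ v) with b <ᵇ a
... | true  = s≤s (count-below-≤ a v)
... | false = m≤n⇒m≤1+n (count-below-≤ a v)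

count-below-< : ∀ a v → a ∈ v → count-below a v < length v
count-below-< a (b ∷ v) (here refl) rewrite <ᵇ-false-complete {b} {b} ≤-refl = s≤s (count-below-≤ b v)
count-below-< a (b ∷ v) (there m) with b <ᵇ a
... | true  = s≤s (count-below-< a v m)
... | false = m≤n⇒m≤1+n (count-below-< a v m)

standardise : List ℕ → List ℕ
standardise v = map (λ a → count-below a v) v

standardise-iso : ∀ v → OrderIso v (standardise v)
standardise-iso v = mkIso (sym (length-map _ v)) same-order
  where
  same-order : ∀ i j → i < length v → j < length v → (at v i <ᵇ at v j) ≡ (at (standardise v) i <ᵇ at (standardise v) j)
  same-order i j hi hj rewrite at-map (λ a → count-below a v) v i hi | at-map (λ a → count-below a v) v j hj
    with at v i <ᵇ at v j in e
  ... | true  = sym (<ᵇ-complete (count-below-strict (at v i) (at v j) v (<ᵇ-sound e) (at-∈ v i hi)))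
  ... | false = sym (<ᵇ-false-complete (count-below-mono (at v j) (at v i) v (<ᵇ-false-sound e)))

standardise-perm : ∀ v → Distinct v → isPermB (standardise v) ≡ true
standardise-perm v d = isPermB-complete (standardise v) bounded distinct
  where
  len = length-map (λ a → count-below a v) v
  iso = standardise-iso v
  bounded : Bounded (standardise v) (length (standardise v))
  bounded t h rewrite len =
    subst (_< length v) (sym (at-map _ v t h)) (count-below-< (at v t) v (at-∈ v t h))
  -- equal standardised entries come from entries neither below the other
  distinct : Distinct (standardise v)
  distinct i j hi hj e = d i j hi' hj' (≤-antisym (notBelow i j hi' hj' e) (notBelow j i hj' hi' (sym e)))
    where
    hi' = subst (i <_) len hi
    hj' = subst (j <_) len hj
    notBelow : ∀ i j → i < length v → j < length v → at (standardise v) i ≡ at (standardise v) j → at v i ≤ at v j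
    notBelow i j hi hj e = <ᵇ-false-sound (trans (iso-order iso j i hj hi) (<ᵇ-false-complete (subst (at (standardise v) i ≤_) e ≤-refl)))

Perm = List ℕ

∑ : List Perm → (Perm → ℤ) → ℤ
∑ L f = sumℤ (map f L)

when : Bool → ℤ → ℤ
when true  v = v
when false v = 0ℤ

∑-++ : ∀ L M f → ∑ (L ++ M) f ≡ ∑ L f +ᶻ ∑ M f
∑-++ []      M f = sym (ℤ.+-identityˡ (∑ M f))
∑-++ (x ∷ L) M f rewrite ∑-++ L M f = sym (ℤ.+-assoc (f x) (∑ L f) (∑ M f))

∑-cong : ∀ L f g → (∀ {x} → x ∈ L → f x ≡ g x) → ∑ L f ≡ ∑ L g
∑-cong []      f g h = refl
∑-cong (x ∷ L) f g h = cong₂ _+ᶻ_ (h (here refl)) (∑-cong L f g (λ m → h (there m)))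

∑-zero : ∀ L f → (∀ {x} → x ∈ L → f x ≡ 0ℤ) → ∑ L f ≡ 0ℤ
∑-zero []      f h = refl
∑-zero (x ∷ L) f h rewrite h (here refl) = trans (ℤ.+-identityˡ _) (∑-zero L f (λ m → h (there m)))

∑-+ : ∀ L f g → ∑ L (λ x → f x +ᶻ g x) ≡ ∑ L f +ᶻ ∑ L g
∑-+ []      f g = refl
∑-+ (x ∷ L) f g rewrite ∑-+ L f g = +-interchange (f x) (g x) (∑ L f) (∑ L g)

∑-*ˡ : ∀ L a f → a *ᶻ ∑ L f ≡ ∑ L (λ x → a *ᶻ f x)
∑-*ˡ []      a f = ℤ.*-zeroʳ a
∑-*ˡ (x ∷ L) a f rewrite sym (∑-*ˡ L a f) = ℤ.*-distribˡ-+ a (f x) (∑ L f)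

∑-*ʳ : ∀ L f a → ∑ L f *ᶻ a ≡ ∑ L (λ x → f x *ᶻ a)
∑-*ʳ L f a = trans (ℤ.*-comm (∑ L f) a) (trans (∑-*ˡ L a f) (∑-cong L _ _ (λ {x} _ → ℤ.*-comm a (f x))))

∑-swap : ∀ L M (h : Perm → Perm → ℤ) → ∑ L (λ x → ∑ M (h x)) ≡ ∑ M (λ y → ∑ L (λ x → h x y))
∑-swap []      M h = sym (∑-zero M (λ _ → 0ℤ) (λ _ → refl))
∑-swap (x ∷ L) M h rewrite ∑-swap L M h = sym (∑-+ M (h x) (λ y → ∑ L (λ x' → h x' y)))

∑-filter : ∀ (p : Perm → Bool) (g : Perm → ℤ) L → ∑ (filterᵇ p L) g ≡ ∑ L (λ z → when (p z) (g z))
∑-filter p g []      = refl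
∑-filter p g (x ∷ L) with p x
... | true  = cong (g x +ᶻ_) (∑-filter p g L)
... | false = trans (∑-filter p g L) (sym (ℤ.+-identityˡ _))

∑-when-split : ∀ L (b c : Perm → Bool) (f : Perm → ℤ) →
               ∑ L (λ z → when (b z) (f z)) ≡ ∑ L (λ z → when (b z ∧ c z) (f z)) +ᶻ ∑ L (λ z → when (b z ∧ not (c z)) (f z))
∑-when-split L b c f = trans (∑-cong L _ _ (λ {z} _ → split (b z) (c z) (f z))) (∑-+ L _ _)
  where
  split : ∀ b c v → when b v ≡ when (b ∧ c) v +ᶻ when (b ∧ not c) v
  split true  true  v = sym (ℤ.+-identityʳ v)
  split true  false v = sym (ℤ.+-identityˡ v)
  split false c     v = refl

∑-when-cong : ∀ L (b c : Perm → Bool) (f : Perm → ℤ) → (∀ {z} → z ∈ L → b z ≡ c z) →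
              ∑ L (λ z → when (b z) (f z)) ≡ ∑ L (λ z → when (c z) (f z))
∑-when-cong L b c f h = ∑-cong L _ _ (λ m → cong (λ b → when b _) (h m))

when-∑ : ∀ b L f → when b (∑ L f) ≡ ∑ L (λ x → when b (f x))
when-∑ true  L f = refl
when-∑ false L f = sym (∑-zero L (λ _ → 0ℤ) (λ _ → refl))

count : Perm → List Perm → ℕ
count z []      = 0
count z (w ∷ L) = if listEqB w z then suc (count z L) else count z L

∑-count-0 : ∀ z L (g : Perm → ℤ) → count z L ≡ 0 → ∑ L (λ w → when (listEqB w z) (g w)) ≡ 0ℤ
∑-count-0 z []      g h = refl
∑-count-0 z (w ∷ L) g h with listEqB w z
... | false = trans (ℤ.+-identityˡ _) (∑-count-0 z L g h)

∑-count-1 : ∀ z L (g : Perm → ℤ) → count z L ≡ 1 → ∑ L (λ w → when (listEqB w z) (g w)) ≡ g z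
∑-count-1 z (w ∷ L) g h with listEqB w z in e
... | true  = trans (cong (g w +ᶻ_) (∑-count-0 z L g (suc-injective h)))
                    (trans (ℤ.+-identityʳ (g w)) (cong g (listEqB-sound e)))
... | false = trans (ℤ.+-identityˡ _) (∑-count-1 z L g h)

count-++ : ∀ z L M → count z (L ++ M) ≡ count z L + count z M
count-++ z []      M = refl
count-++ z (w ∷ L) M with listEqB w z
... | true  = cong suc (count-++ z L M)
... | false = count-++ z L M

count-concatMap : ∀ {A : Set} z (f : A → List Perm) (L : List A) →
                  count z (concatMap f L) ≡ sum (map (λ a → count z (f a)) L)
count-concatMap z f []      = refl
count-concatMap z f (a ∷ L) = trans (count-++ z (f a) (concatMap f L)) (cong (count z (f a) +_) (count-concatMap z f L))

count-absent : ∀ z L → (∀ {w} → w ∈ L → w ≢ z) → count z L ≡ 0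
count-absent z []      f = refl
count-absent z (w ∷ L) f rewrite listEqB-false-complete (f (here refl)) = count-absent z L (λ m → f (there m))

count-filter : ∀ (p : Perm → Bool) z L → p z ≡ true → count z (filterᵇ p L) ≡ count z L
count-filter p z []      h = refl
count-filter p z (w ∷ L) h with p w in e
... | true with listEqB w z
...   | true  = cong suc (count-filter p z L h)
...   | false = count-filter p z L h
count-filter p z (w ∷ L) h | false with listEqB w z in e₂
...   | false = count-filter p z L h
...   | true  = ⊥-elim (true≢false (subst (λ q → p q ≡ true) (sym (listEqB-sound e₂)) h) e)

∈-filter : ∀ (p : Perm → Bool) L {w} → w ∈ filterᵇ p L → p w ≡ true × w ∈ L
∈-filter p (x ∷ L) m with p x in e
∈-filter p (x ∷ L) (here refl) | true = e , here refl
∈-filter p (x ∷ L) (there m)   | true with ∈-filter p L m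
... | pw , w∈L = pw , there w∈L
∈-filter p (x ∷ L) m | false with ∈-filter p L m
... | pw , w∈L = pw , there w∈L

countℕ : ℕ → List ℕ → ℕ
countℕ h []      = 0
countℕ h (a ∷ L) = if a ≡ᵇ h then suc (countℕ h L) else countℕ h L

countℕ-interval : ∀ h a n → a ≤ h → h < a + n → countℕ h (interval a n) ≡ 1
countℕ-interval h a zero    lo hi = ⊥-elim (<-irrefl refl (≤-<-trans lo (subst (h <_) (+-identityʳ a) hi)))
countℕ-interval h a (suc n) lo hi with a ≟ h
... | yes refl rewrite ≡ᵇ-complete {a} refl = cong suc (above (suc a) n ≤-refl)
  where
  above : ∀ b n → suc a ≤ b → countℕ a (interval b n) ≡ 0
  above b zero    _  = refl
  above b (suc n) le rewrite ≡ᵇ-false-complete {b} {a} (λ e → <-irrefl (sym e) le) = above (suc b) n (m≤n⇒m≤1+n le)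
... | no  a≢h rewrite ≡ᵇ-false-complete {a} {h} a≢h = countℕ-interval h (suc a) n (≤∧≢⇒< lo a≢h) (subst (h <_) (+-suc a n) hi)

count-prepend : ∀ h z w L → count (h ∷ z) (map (_∷ w) L) ≡ (if listEqB w z then countℕ h L else 0)
count-prepend h z w [] with listEqB w z
... | true  = refl
... | false = refl
count-prepend h z w (a ∷ L) with listEqB w z in e | a ≡ᵇ h
... | true  | true  = cong suc (trans (count-prepend h z w L) (cong (λ b → if b then countℕ h L else 0) e))
... | true  | false = trans (count-prepend h z w L) (cong (λ b → if b then countℕ h L else 0) e)
... | false | true  = trans (count-prepend h z w L) (cong (λ b → if b then countℕ h L else 0) e)
... | false | false = trans (count-prepend h z w L) (cong (λ b → if b then countℕ h L else 0) e)

sum-cong : ∀ {A : Set} (f g : A → ℕ) L → (∀ a → f a ≡ g a) → sum (map f L) ≡ sum (map g L)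
sum-cong f g []      h = refl
sum-cong f g (a ∷ L) h = cong₂ _+_ (h a) (sum-cong f g L h)

sum-indicator : ∀ z W → sum (map (λ w → if listEqB w z then 1 else 0) W) ≡ count z W
sum-indicator z []      = refl
sum-indicator z (w ∷ W) with listEqB w z
... | true  = cong suc (sum-indicator z W)
... | false = sum-indicator z W

count-words : ∀ k l z → length z ≡ l → Bounded z k → count z (words k l) ≡ 1
count-words k zero    []      _  _ = refl
count-words k (suc l) (h ∷ z) ln b =
  trans (count-concatMap (h ∷ z) (λ w → map (_∷ w) (upTo k)) (words k l))
  (trans (sum-cong _ (λ w → if listEqB w z then 1 else 0) (words k l) oneLetter)
  (trans (sum-indicator z (words k l)) (count-words k l z (suc-injective ln) (λ t p → b (suc t) (s<s p)))))
  where
  letter : countℕ h (upTo k) ≡ 1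
  letter rewrite upTo-interval k = countℕ-interval h 0 k z≤n (b zero (s≤s z≤n))
  oneLetter : ∀ w → count (h ∷ z) (map (_∷ w) (upTo k)) ≡ (if listEqB w z then 1 else 0)
  oneLetter w rewrite count-prepend h z w (upTo k) | letter = refl

words-length : ∀ k l {w} → w ∈ words k l → length w ≡ l
words-length k zero    (here refl) = refl
words-length k (suc l) {w} m with ∈-concat⁻′ (map (λ w → map (_∷ w) (upTo k)) (words k l)) m
... | xs , m₁ , m₂ with ∈-map⁻ _ m₂
... | w' , m₃ , refl with ∈-map⁻ _ m₁
... | a , _ , refl = cong suc (words-length k l m₃)

permsUpTo : ℕ → List Perm
permsUpTo n = concatMap perms (upTo (suc n))

∈-perms : ∀ k {w} → w ∈ perms k → isPermB w ≡ true × length w ≡ k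
∈-perms k m with ∈-filter isPermB (words k k) m
... | p , w∈ = p , words-length k k w∈

count-perms : ∀ z k → isPermB z ≡ true → count z (perms k) ≡ (if k ≡ᵇ length z then 1 else 0)
count-perms z k hz with k ≟ length z
... | yes refl rewrite ≡ᵇ-complete {k} refl =
  trans (count-filter isPermB z (words k k) hz) (count-words k k z refl (proj₁ (isPermB-sound z hz)))
... | no  k≢ rewrite ≡ᵇ-false-complete {k} {length z} k≢ =
  count-absent z (perms k) (λ m e → k≢ (trans (sym (proj₂ (∈-perms k m))) (cong length e)))

count-permsUpTo : ∀ n z → isPermB z ≡ true → length z ≤ n → count z (permsUpTo n) ≡ 1
count-permsUpTo n z hz hl =
  trans (count-concatMap z perms (upTo (suc n)))
  (trans (sum-cong _ _ (upTo (suc n)) (λ k → count-perms z k hz))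
  (trans (sum-lengths (upTo (suc n)))
         (subst (λ R → countℕ (length z) R ≡ 1) (sym (upTo-interval (suc n))) (countℕ-interval (length z) 0 (suc n) z≤n (s≤s hl)))))
  where
  sum-lengths : ∀ R → sum (map (λ k → if k ≡ᵇ length z then 1 else 0) R) ≡ countℕ (length z) R
  sum-lengths []      = refl
  sum-lengths (k ∷ R) with k ≡ᵇ length z
  ... | true  = cong suc (sum-lengths R)
  ... | false = sum-lengths R

∈-permsUpTo : ∀ n {w} → w ∈ permsUpTo n → isPermB w ≡ true × length w ≤ n
∈-permsUpTo n {w} m with ∈-concat⁻′ (map perms (upTo (suc n))) m
... | xs , m₁ , m₂ with ∈-map⁻ _ m₂
... | k , m₃ , refl with ∈-perms k m₁
... | p , refl = p , s≤s⁻¹ (proj₂ (∈-interval 0 (suc n) (subst (length w ∈_) (upTo-interval (suc n)) m₃)))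

permsUpTo-split : ∀ m n → m ≤ n → permsUpTo n ≡ permsUpTo m ++ concatMap perms (interval (suc m) (n ∸ m))
permsUpTo-split m n le =
  trans (cong (concatMap perms) (trans (upTo-interval (suc n))
          (trans (cong (interval 0) (sym (cong suc (m+[n∸m]≡n le)))) (interval-++ 0 (suc m) (n ∸ m)))))
  (trans (concatMap-++ perms (interval 0 (suc m)) (interval (suc m) (n ∸ m)))
         (cong (λ L → concatMap perms L ++ concatMap perms (interval (suc m) (n ∸ m))) (sym (upTo-interval (suc m)))))

∈-longer : ∀ m d {w} → w ∈ concatMap perms (interval (suc m) d) → m < length w
∈-longer m d {w} mem with ∈-concat⁻′ (map perms (interval (suc m) d)) mem
... | xs , m₁ , m₂ with ∈-map⁻ _ m₂
... | k , m₃ , refl with ∈-perms k m₁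
... | _ , refl = proj₁ (∈-interval (suc m) d m₃)

inclusion-exclusion : ∀ e a b v → (e ≡ true → a ≡ false) → (e ≡ true → b ≡ false) →
                      when (e ∨ (a ∨ b)) v +ᶻ when (a ∧ b) v ≡ (when e v +ᶻ when a v) +ᶻ when b v
inclusion-exclusion true  a     b     v ea eb rewrite ea refl | eb refl = sym (ℤ.+-identityʳ (v +ᶻ 0ℤ))
inclusion-exclusion false true  true  v _  _  = cong (_+ᶻ v) (sym (ℤ.+-identityˡ v))
inclusion-exclusion false true  false v _  _  = cong (_+ᶻ 0ℤ) (sym (ℤ.+-identityˡ v))
inclusion-exclusion false false true  v _  _  = trans (ℤ.+-identityʳ v) (sym (ℤ.+-identityˡ v))
inclusion-exclusion false false false v _  _  = refl

_⊑_ : Perm → Perm → Bool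
x ⊑ y = containsB x y

strictly-shorter : ∀ z y → isPermB z ≡ true → isPermB y ≡ true → z ⊑ y ≡ true → listEqB z y ≡ false → length z < length y
strictly-shorter z y hz hy h z≢y with length z ≟ length y
... | yes same = ⊥-elim (listEqB-false-sound z≢y (contains-antisym z y hz hy h same))
... | no  diff = ≤∧≢⇒< (contains-length z y h) diff

StrictlyBelow : Perm → Perm → Perm → Bool
StrictlyBelow x y z = x ⊑ z ∧ z ⊑ y ∧ not (listEqB z y)

strictly-below : ∀ x y z → StrictlyBelow x y z ≡ true → z ⊑ y ≡ true × listEqB z y ≡ false
strictly-below x y z h = ∧-projˡ {z ⊑ y} rest , not-true (∧-projʳ {z ⊑ y} rest)
  where
  rest = ∧-projʳ {x ⊑ z} h

-- The fuel in `mobiusF` only has to exceed the length of the upper argument: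
-- strictly smaller elements are strictly shorter.

μ-fuel-step : ∀ f x y → isPermB y ≡ true → length y < f → mobiusF f x y ≡ mobiusF (suc f) x y
μ-fuel-step (suc f) x y hy lt with listEqB x y | containsB x y
... | true  | _     = refl
... | false | false = refl
... | false | true  = cong -_ (∑-cong (filterᵇ P (permsUpTo (length y))) (mobiusF f x) (mobiusF (suc f) x) below)
  where
  P = StrictlyBelow x y
  below : ∀ {z} → z ∈ filterᵇ P (permsUpTo (length y)) → mobiusF f x z ≡ mobiusF (suc f) x z
  below {z} m with ∈-filter P (permsUpTo (length y)) m
  ... | pz , z∈ = μ-fuel-step f x z hz (<-≤-trans (strictly-shorter z y hz hy (proj₁ zy) (proj₂ zy)) (s≤s⁻¹ lt))
    where
    hz = proj₁ (∈-permsUpTo (length y) z∈)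
    zy = strictly-below x y z pz

μ-fuel-+ : ∀ k x y → isPermB y ≡ true → mobiusF (k + suc (length y)) x y ≡ μ x y
μ-fuel-+ zero    x y hy = refl
μ-fuel-+ (suc k) x y hy =
  trans (sym (μ-fuel-step (k + suc (length y)) x y hy (≤-trans (n<1+n (length y)) (m≤n+m (suc (length y)) k))))
        (μ-fuel-+ k x y hy)

μ-fuel : ∀ f x y → isPermB y ≡ true → length y < f → mobiusF f x y ≡ μ x y
μ-fuel f x y hy lt = trans (cong (λ g → mobiusF g x y) (sym (trans (+-comm (f ∸ suc (length y)) (suc (length y))) (m+[n∸m]≡n lt))))
                           (μ-fuel-+ (f ∸ suc (length y)) x y hy)

-- Möbius algebra inside the interval below a fixed permutation τ, with all sums taken
-- over the universe U of permutations of length at most |τ|.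
module Interval (τ : Perm) (hτ : isPermB τ ≡ true) where

  n = length τ
  U = permsUpTo n

  U-perm : ∀ {w} → w ∈ U → isPermB w ≡ true
  U-perm m = proj₁ (∈-permsUpTo n m)

  U-length : ∀ {w} → w ∈ U → length w ≤ n
  U-length m = proj₂ (∈-permsUpTo n m)

  -- the defining recursion of μ, with the sum extended to all of U
  μ-rec : ∀ x y → isPermB y ≡ true → length y ≤ n → listEqB x y ≡ false → x ⊑ y ≡ true →
          μ x y ≡ - ∑ U (λ z → when (StrictlyBelow x y z) (μ x z))
  μ-rec x y hy ly x≢y x⊑y rewrite x≢y | x⊑y = cong -_ (begin
      ∑ (filterᵇ P (permsUpTo (length y))) (mobiusF (length y) x)
        ≡⟨ ∑-filter P (mobiusF (length y) x) (permsUpTo (length y)) ⟩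
      ∑ (permsUpTo (length y)) (λ z → when (P z) (mobiusF (length y) x z))
        ≡⟨ ∑-cong (permsUpTo (length y)) _ _ refuel ⟩
      ∑ (permsUpTo (length y)) G
        ≡⟨ sym (ℤ.+-identityʳ _) ⟩
      ∑ (permsUpTo (length y)) G +ᶻ 0ℤ
        ≡⟨ cong (∑ (permsUpTo (length y)) G +ᶻ_) (sym (∑-zero Longer G tooLong)) ⟩
      ∑ (permsUpTo (length y)) G +ᶻ ∑ Longer G
        ≡⟨ sym (∑-++ (permsUpTo (length y)) Longer G) ⟩
      ∑ (permsUpTo (length y) ++ Longer) G
        ≡⟨ cong (λ L → ∑ L G) (sym (permsUpTo-split (length y) n ly)) ⟩
      ∑ U G ∎)
    where
    open ≡-Reasoning
    P = StrictlyBelow x y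
    G : Perm → ℤ
    G z = when (P z) (μ x z)
    Longer = concatMap perms (interval (suc (length y)) (n ∸ length y))
    refuel : ∀ {z} → z ∈ permsUpTo (length y) → when (P z) (mobiusF (length y) x z) ≡ G z
    refuel {z} m with P z in e
    ... | false = refl
    ... | true  = μ-fuel (length y) x z hz (strictly-shorter z y hz hy (proj₁ zy) (proj₂ zy))
      where
      hz = proj₁ (∈-permsUpTo (length y) m)
      zy = strictly-below x y z e
    tooLong : ∀ {z} → z ∈ Longer → G z ≡ 0ℤ
    tooLong {z} m with P z in e
    ... | false = refl
    ... | true  = ⊥-elim (<-irrefl refl (≤-<-trans (contains-length z y (proj₁ (strictly-below x y z e))) (∈-longer (length y) (n ∸ length y) m)))

  ∑-peel : ∀ z (P : Perm → Bool) (g : Perm → ℤ) → isPermB z ≡ true → length z ≤ n → P z ≡ true →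
           ∑ U (λ w → when (P w) (g w)) ≡ g z +ᶻ ∑ U (λ w → when (P w ∧ not (listEqB w z)) (g w))
  ∑-peel z P g hz lz pz =
    trans (∑-when-split U P (λ w → listEqB w z) g)
          (cong (_+ᶻ ∑ U (λ w → when (P w ∧ not (listEqB w z)) (g w)))
                (trans (∑-when-cong U _ (λ w → listEqB w z) g (λ {w} _ → onlyZ w))
                       (∑-count-1 z U g (count-permsUpTo n z hz lz))))
    where
    onlyZ : ∀ w → (P w ∧ listEqB w z) ≡ listEqB w z
    onlyZ w = bool-ext ∧-projʳ (λ e → ∧-intro (subst (λ q → P q ≡ true) (sym (listEqB-sound e)) pz) e)

  no-strict-loop : ∀ x w → isPermB x ≡ true → w ∈ U → x ⊑ w ≡ true → w ⊑ x ≡ true → listEqB w x ≡ false → ⊥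
  no-strict-loop x w hx m x⊑w w⊑x w≢x =
    listEqB-false-sound w≢x (contains-antisym w x (U-perm m) hx w⊑x (≤-antisym (contains-length w x w⊑x) (contains-length x w x⊑w)))

  -- after splitting off z = y, the sum of μ(x, ·) over [x, y] is 1 if x = y and 0
  -- otherwise (the remaining terms are empty, resp. cancel μ(x, y) by its recursion)
  μ-interval-peeled : ∀ x y → isPermB x ≡ true → isPermB y ≡ true → length y ≤ n → x ⊑ y ≡ true →
                      μ x y +ᶻ ∑ U (λ z → when ((x ⊑ z ∧ z ⊑ y) ∧ not (listEqB z y)) (μ x z)) ≡ when (listEqB y x) 1ℤ
  μ-interval-peeled x y hx hy ly x⊑y with bool-cases (listEqB x y)
  ... | inj₁ x≡y with listEqB-sound {x} {y} x≡y
  ...   | refl rewrite listEqB-refl x = trans (cong (1ℤ +ᶻ_) (∑-zero U _ empty)) (ℤ.+-identityʳ 1ℤ)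
    where
    empty : ∀ {z} → z ∈ U → when ((x ⊑ z ∧ z ⊑ x) ∧ not (listEqB z x)) (μ x z) ≡ 0ℤ
    empty {z} m with x ⊑ z in e₁ | z ⊑ x in e₂ | listEqB z x in e₃
    ... | false | _     | _     = refl
    ... | true  | false | _     = refl
    ... | true  | true  | true  = refl
    ... | true  | true  | false = ⊥-elim (no-strict-loop x z hx m e₁ e₂ e₃)
  μ-interval-peeled x y hx hy ly x⊑y | inj₂ x≢y
    rewrite μ-rec x y hy ly x≢y x⊑y | listEqB-false-complete {y} {x} (λ e → listEqB-false-sound x≢y (sym e)) =
    trans (cong (λ S → - S +ᶻ Rest) (∑-when-cong U _ _ (μ x) (λ {z} _ → sym (∧-assoc (x ⊑ z) (z ⊑ y) (not (listEqB z y))))))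
          (ℤ.+-inverseˡ Rest)
    where
    Rest = ∑ U (λ z → when ((x ⊑ z ∧ z ⊑ y) ∧ not (listEqB z y)) (μ x z))

  μ-interval-sum : ∀ x y → isPermB x ≡ true → isPermB y ≡ true → length y ≤ n → x ⊑ y ≡ true →
                   ∑ U (λ z → when (x ⊑ z ∧ z ⊑ y) (μ x z)) ≡ when (listEqB y x) 1ℤ
  μ-interval-sum x y hx hy ly x⊑y =
    trans (∑-peel y (λ z → x ⊑ z ∧ z ⊑ y) (μ x) hy ly (∧-intro x⊑y (contains-refl y))) (μ-interval-peeled x y hx hy ly x⊑y)

  -- The dual Möbius function μ↑(z) = μ(z, τ), defined by the recursion from the top:
  -- μ↑(τ) = 1 and μ↑(z) = -Σ_{z < w ≤ τ} μ↑(w).  Its fuel is bounded by n - |z|.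

  StrictlyAbove : Perm → Perm → Bool
  StrictlyAbove z w = z ⊑ w ∧ w ⊑ τ ∧ not (listEqB w z)

  μ↑-fuel : ℕ → Perm → ℤ
  μ↑-fuel zero    z = 0ℤ
  μ↑-fuel (suc f) z = if listEqB z τ then 1ℤ else - ∑ U (λ w → when (StrictlyAbove z w) (μ↑-fuel f w))

  μ↑ : Perm → ℤ
  μ↑ z = μ↑-fuel (suc (n ∸ length z)) z

  -- going up strictly decreases the remaining fuel n - |z|
  strictly-above-gap : ∀ z w → isPermB z ≡ true → w ∈ U → StrictlyAbove z w ≡ true → n ∸ length w < n ∸ length z
  strictly-above-gap z w hz m h =
    ∸-monoʳ-< (strictly-shorter z w hz (U-perm m) (∧-projˡ {z ⊑ w} h)
                 (listEqB-false-complete {z} {w} (λ e → listEqB-false-sound {w} {z} (not-true (∧-projʳ {w ⊑ τ} (∧-projʳ {z ⊑ w} h))) (sym e))))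
              (U-length m)

  μ↑-fuel-step : ∀ f z → isPermB z ≡ true → n ∸ length z < f → μ↑-fuel f z ≡ μ↑-fuel (suc f) z
  μ↑-fuel-step (suc f) z hz lt with listEqB z τ
  ... | true  = refl
  ... | false = cong -_ (∑-cong U _ _ above)
    where
    above : ∀ {w} → w ∈ U → when (StrictlyAbove z w) (μ↑-fuel f w) ≡ when (StrictlyAbove z w) (μ↑-fuel (suc f) w)
    above {w} m with StrictlyAbove z w in e
    ... | false = refl
    ... | true  = μ↑-fuel-step f w (U-perm m) (<-≤-trans (strictly-above-gap z w hz m e) (s≤s⁻¹ lt))

  μ↑-fuel-+ : ∀ k z → isPermB z ≡ true → μ↑-fuel (k + suc (n ∸ length z)) z ≡ μ↑ z
  μ↑-fuel-+ zero    z hz = refl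
  μ↑-fuel-+ (suc k) z hz =
    trans (sym (μ↑-fuel-step (k + suc (n ∸ length z)) z hz (≤-trans (n<1+n _) (m≤n+m (suc (n ∸ length z)) k))))
          (μ↑-fuel-+ k z hz)

  μ↑-rec : ∀ z → isPermB z ≡ true → listEqB z τ ≡ false → μ↑ z ≡ - ∑ U (λ w → when (StrictlyAbove z w) (μ↑ w))
  μ↑-rec z hz z≢τ rewrite z≢τ = cong -_ (∑-cong U _ _ refuel)
    where
    refuel : ∀ {w} → w ∈ U → when (StrictlyAbove z w) (μ↑-fuel (n ∸ length z) w) ≡ when (StrictlyAbove z w) (μ↑ w)
    refuel {w} m with StrictlyAbove z w in e
    ... | false = refl
    ... | true  = trans (cong (λ f → μ↑-fuel f w) (sym (trans (+-comm (d ∸ suc (n ∸ length w)) (suc (n ∸ length w)))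
                                                              (m+[n∸m]≡n (strictly-above-gap z w hz m e)))))
                        (μ↑-fuel-+ (d ∸ suc (n ∸ length w)) w (U-perm m))
      where d = n ∸ length z

  μ↑-interval-peeled : ∀ z → isPermB z ≡ true → z ⊑ τ ≡ true →
                       μ↑ z +ᶻ ∑ U (λ w → when ((z ⊑ w ∧ w ⊑ τ) ∧ not (listEqB w z)) (μ↑ w)) ≡ when (listEqB z τ) 1ℤ
  μ↑-interval-peeled z hz z⊑τ with bool-cases (listEqB z τ)
  ... | inj₁ z≡τ with listEqB-sound {z} {τ} z≡τ
  ...   | refl rewrite listEqB-refl z = trans (cong (1ℤ +ᶻ_) (∑-zero U _ empty)) (ℤ.+-identityʳ 1ℤ)
    where
    empty : ∀ {w} → w ∈ U → when ((z ⊑ w ∧ w ⊑ z) ∧ not (listEqB w z)) (μ↑ w) ≡ 0ℤ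
    empty {w} m with z ⊑ w in e₁ | w ⊑ z in e₂ | listEqB w z in e₃
    ... | false | _     | _     = refl
    ... | true  | false | _     = refl
    ... | true  | true  | true  = refl
    ... | true  | true  | false = ⊥-elim (no-strict-loop z w hz m e₁ e₂ e₃)
  μ↑-interval-peeled z hz z⊑τ | inj₂ z≢τ rewrite μ↑-rec z hz z≢τ | z≢τ =
    trans (cong (λ S → - S +ᶻ Rest) (∑-when-cong U _ _ μ↑ (λ {w} _ → sym (∧-assoc (z ⊑ w) (w ⊑ τ) (not (listEqB w z))))))
          (ℤ.+-inverseˡ Rest)
    where
    Rest = ∑ U (λ w → when ((z ⊑ w ∧ w ⊑ τ) ∧ not (listEqB w z)) (μ↑ w))

  μ↑-interval-sum : ∀ z → isPermB z ≡ true → length z ≤ n → z ⊑ τ ≡ true →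
                    ∑ U (λ w → when (z ⊑ w ∧ w ⊑ τ) (μ↑ w)) ≡ when (listEqB z τ) 1ℤ
  μ↑-interval-sum z hz lz z⊑τ =
    trans (∑-peel z (λ w → z ⊑ w ∧ w ⊑ τ) μ↑ hz lz (∧-intro (contains-refl z) z⊑τ)) (μ↑-interval-peeled z hz z⊑τ)

  -- μ(x, τ) = μ↑(x): both equal the sum of μ(x, z)·μ↑(w) over chains x ≤ z ≤ w ≤ τ,
  -- summing first over w (using the interval sums of μ↑) or first over z (those of μ).

  Chain : Perm → Perm → Perm → Bool
  Chain x z w = x ⊑ z ∧ z ⊑ w ∧ w ⊑ τ

  chain-lower : ∀ x z w → ((x ⊑ z ∧ z ⊑ τ) ∧ (z ⊑ w ∧ w ⊑ τ)) ≡ Chain x z w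
  chain-lower x z w = bool-ext
    (λ e → ∧-intro (∧-projˡ {x ⊑ z} (∧-projˡ {x ⊑ z ∧ z ⊑ τ} e)) (∧-projʳ {x ⊑ z ∧ z ⊑ τ} e))
    (λ e → let z⊑w = ∧-projˡ {z ⊑ w} (∧-projʳ {x ⊑ z} e) ; w⊑τ = ∧-projʳ {z ⊑ w} (∧-projʳ {x ⊑ z} e)
           in ∧-intro (∧-intro (∧-projˡ {x ⊑ z} e) (contains-trans z w τ z⊑w w⊑τ)) (∧-intro z⊑w w⊑τ))

  chain-upper : ∀ x z w → ((x ⊑ w ∧ w ⊑ τ) ∧ (x ⊑ z ∧ z ⊑ w)) ≡ Chain x z w
  chain-upper x z w = bool-ext
    (λ e → let xz = ∧-projʳ {x ⊑ w ∧ w ⊑ τ} e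
           in ∧-intro (∧-projˡ {x ⊑ z} xz) (∧-intro (∧-projʳ {x ⊑ z} xz) (∧-projʳ {x ⊑ w} (∧-projˡ {x ⊑ w ∧ w ⊑ τ} e))))
    (λ e → let x⊑z = ∧-projˡ {x ⊑ z} e ; z⊑w = ∧-projˡ {z ⊑ w} (∧-projʳ {x ⊑ z} e) ; w⊑τ = ∧-projʳ {z ⊑ w} (∧-projʳ {x ⊑ z} e)
           in ∧-intro (∧-intro (contains-trans x z w x⊑z z⊑w) w⊑τ) (∧-intro x⊑z z⊑w))

  when-*-∑ : ∀ c d (b : Perm → Bool) (v : Perm → ℤ) →
             when c (d *ᶻ ∑ U (λ w → when (b w) (v w))) ≡ ∑ U (λ w → when (c ∧ b w) (d *ᶻ v w))
  when-*-∑ c d b v =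
    trans (cong (when c) (∑-*ˡ U d _)) (trans (when-∑ c U _) (∑-cong U _ _ (λ {w} _ → guard c (b w) (v w))))
    where
    guard : ∀ c b v → when c (d *ᶻ when b v) ≡ when (c ∧ b) (d *ᶻ v)
    guard true  true  v = refl
    guard true  false v = ℤ.*-zeroʳ d
    guard false b     v = refl

  when-∑-* : ∀ c (b : Perm → Bool) (d : Perm → ℤ) v →
             when c (∑ U (λ z → when (b z) (d z)) *ᶻ v) ≡ ∑ U (λ z → when (c ∧ b z) (d z *ᶻ v))
  when-∑-* c b d v =
    trans (cong (when c) (∑-*ʳ U (λ z → when (b z) (d z)) v)) (trans (when-∑ c U _) (∑-cong U _ _ (λ {z} _ → guard c (b z) (d z))))
    where
    guard : ∀ c b d → when c (when b d *ᶻ v) ≡ when (c ∧ b) (d *ᶻ v)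
    guard true  true  d = refl
    guard true  false d = refl
    guard false b     d = refl

  module _ (x : Perm) (hx : isPermB x ≡ true) (x⊑τ : x ⊑ τ ≡ true) where

    ChainSum : Perm → Perm → ℤ
    ChainSum z w = when (Chain x z w) (μ x z *ᶻ μ↑ w)

    μ-chain-sum : μ x τ ≡ ∑ U (λ z → ∑ U (λ w → ChainSum z w))
    μ-chain-sum = trans (sym (∑-count-1 τ U (μ x) (count-permsUpTo n τ hτ ≤-refl))) (∑-cong U _ _ expand)
      where
      expand : ∀ {z} → z ∈ U → when (listEqB z τ) (μ x z) ≡ ∑ U (λ w → ChainSum z w)
      expand {z} m = trans (select (x ⊑ z ∧ z ⊑ τ) refl)
                           (trans (when-*-∑ (x ⊑ z ∧ z ⊑ τ) (μ x z) (λ w → z ⊑ w ∧ w ⊑ τ) μ↑)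
                                  (∑-when-cong U _ _ _ (λ {w} _ → chain-lower x z w)))
        where
        -- the inner sum of μ↑ over [z, τ] is the indicator of z = τ
        select : ∀ c → c ≡ (x ⊑ z ∧ z ⊑ τ) →
                 when (listEqB z τ) (μ x z) ≡ when c (μ x z *ᶻ ∑ U (λ w → when (z ⊑ w ∧ w ⊑ τ) (μ↑ w)))
        select true  e rewrite μ↑-interval-sum z (U-perm m) (U-length m) (∧-projʳ {x ⊑ z} (sym e)) with listEqB z τ
        ... | true  = sym (ℤ.*-identityʳ (μ x z))
        ... | false = sym (ℤ.*-zeroʳ (μ x z))
        select false e with listEqB z τ in z≡τ
        ... | false = refl
        ... | true  = ⊥-elim (true≢false (subst (λ q → (x ⊑ q ∧ q ⊑ τ) ≡ true) (sym (listEqB-sound {z} {τ} z≡τ))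
                                                 (∧-intro {x ⊑ τ} {τ ⊑ τ} x⊑τ (contains-refl τ))) (sym e))

    μ↑-chain-sum : μ↑ x ≡ ∑ U (λ w → ∑ U (λ z → ChainSum z w))
    μ↑-chain-sum = trans (sym (∑-count-1 x U μ↑ (count-permsUpTo n x hx (contains-length x τ x⊑τ)))) (∑-cong U _ _ expand)
      where
      expand : ∀ {w} → w ∈ U → when (listEqB w x) (μ↑ w) ≡ ∑ U (λ z → ChainSum z w)
      expand {w} m = trans (select (x ⊑ w ∧ w ⊑ τ) refl)
                           (trans (when-∑-* (x ⊑ w ∧ w ⊑ τ) (λ z → x ⊑ z ∧ z ⊑ w) (μ x) (μ↑ w))
                                  (∑-when-cong U _ _ _ (λ {z} _ → chain-upper x z w)))
        where
        -- the inner sum of μ(x, ·) over [x, w] is the indicator of w = x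
        select : ∀ c → c ≡ (x ⊑ w ∧ w ⊑ τ) →
                 when (listEqB w x) (μ↑ w) ≡ when c (∑ U (λ z → when (x ⊑ z ∧ z ⊑ w) (μ x z)) *ᶻ μ↑ w)
        select true  e rewrite μ-interval-sum x w hx (U-perm m) (U-length m) (∧-projˡ {x ⊑ w} (sym e)) with listEqB w x
        ... | true  = sym (ℤ.*-identityˡ (μ↑ w))
        ... | false = refl
        select false e with listEqB w x in w≡x
        ... | false = refl
        ... | true  = ⊥-elim (true≢false (subst (λ q → (x ⊑ q ∧ q ⊑ τ) ≡ true) (sym (listEqB-sound {w} {x} w≡x))
                                                 (∧-intro {x ⊑ x} {x ⊑ τ} (contains-refl x) x⊑τ)) (sym e))

    μ≡μ↑ : μ x τ ≡ μ↑ x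
    μ≡μ↑ = trans μ-chain-sum (trans (∑-swap U U ChainSum) (sym μ↑-chain-sum))

  record Proper (x : Perm) : Set where
    field
      proper-perm  : isPermB x ≡ true
      proper-below : x ⊑ τ ≡ true
      proper-≢     : listEqB x τ ≡ false
  open Proper public

  μ↑-proper-sum : ∀ x → Proper x → ∑ U (λ w → when (x ⊑ w ∧ w ⊑ τ) (μ↑ w)) ≡ 0ℤ
  μ↑-proper-sum x p =
    trans (μ↑-interval-sum x (proper-perm p) (contains-length x τ (proper-below p)) (proper-below p))
          (cong (λ b → when b 1ℤ) (proper-≢ p))

  -- (σ, τ] is covered by the two up-sets of ρ₁ and ρ₂ (both above σ), whose
  -- intersection is the up-set of ρ₁₂.
  record TwoCover (σ ρ₁ ρ₂ ρ₁₂ : Perm) : Set where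
    field
      proper-σ   : Proper σ
      proper-ρ₁  : Proper ρ₁
      proper-ρ₂  : Proper ρ₂
      proper-ρ₁₂ : Proper ρ₁₂
      σ⊑ρ₁       : σ ⊑ ρ₁ ≡ true
      σ⊑ρ₂       : σ ⊑ ρ₂ ≡ true
      σ<ρ₁       : length σ < length ρ₁
      σ<ρ₂       : length σ < length ρ₂
      ρ₁⊑ρ₁₂     : ρ₁ ⊑ ρ₁₂ ≡ true
      ρ₂⊑ρ₁₂     : ρ₂ ⊑ ρ₁₂ ≡ true
      cover      : ∀ w → isPermB w ≡ true → σ ⊑ w ≡ true → w ⊑ τ ≡ true → listEqB w σ ≡ false →
                   ρ₁ ⊑ w ≡ true ⊎ ρ₂ ⊑ w ≡ true
      join       : ∀ w → w ⊑ τ ≡ true → ρ₁ ⊑ w ≡ true → ρ₂ ⊑ w ≡ true → ρ₁₂ ⊑ w ≡ true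

  Up : Perm → Perm → Bool
  Up x w = x ⊑ w ∧ w ⊑ τ

  module TwoCoverFacts {σ ρ₁ ρ₂ ρ₁₂} (C : TwoCover σ ρ₁ ρ₂ ρ₁₂) where
    open TwoCover C

    union : ∀ w → isPermB w ≡ true → Up σ w ≡ (listEqB w σ ∨ (Up ρ₁ w ∨ Up ρ₂ w))
    union w hw = ∨₃-ext to (λ e → subst (λ q → Up σ q ≡ true) (sym (listEqB-sound {w} {σ} e)) σ∈)
                           (above ρ₁ σ⊑ρ₁) (above ρ₂ σ⊑ρ₂)
      where
      σ∈ : Up σ σ ≡ true
      σ∈ = ∧-intro {σ ⊑ σ} (contains-refl σ) (proper-below proper-σ)
      above : ∀ ρ → σ ⊑ ρ ≡ true → Up ρ w ≡ true → Up σ w ≡ true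
      above ρ σ⊑ρ h = ∧-intro {σ ⊑ w} (contains-trans σ ρ w σ⊑ρ (∧-projˡ {ρ ⊑ w} h)) (∧-projʳ {ρ ⊑ w} h)
      to : Up σ w ≡ true → listEqB w σ ≡ true ⊎ Up ρ₁ w ≡ true ⊎ Up ρ₂ w ≡ true
      to h with listEqB w σ in e
      ... | true  = inj₁ refl
      ... | false with cover w hw (∧-projˡ {σ ⊑ w} h) (∧-projʳ {σ ⊑ w} h) e
      ...   | inj₁ ρ₁⊑w = inj₂ (inj₁ (∧-intro {ρ₁ ⊑ w} ρ₁⊑w (∧-projʳ {σ ⊑ w} h)))
      ...   | inj₂ ρ₂⊑w = inj₂ (inj₂ (∧-intro {ρ₂ ⊑ w} ρ₂⊑w (∧-projʳ {σ ⊑ w} h)))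

    intersection : ∀ w → Up ρ₁₂ w ≡ (Up ρ₁ w ∧ Up ρ₂ w)
    intersection w = bool-ext
      (λ h → let w⊑τ = ∧-projʳ {ρ₁₂ ⊑ w} h ; ρ₁₂⊑w = ∧-projˡ {ρ₁₂ ⊑ w} h in
             ∧-intro {Up ρ₁ w} (∧-intro {ρ₁ ⊑ w} (contains-trans ρ₁ ρ₁₂ w ρ₁⊑ρ₁₂ ρ₁₂⊑w) w⊑τ)
                               (∧-intro {ρ₂ ⊑ w} (contains-trans ρ₂ ρ₁₂ w ρ₂⊑ρ₁₂ ρ₁₂⊑w) w⊑τ))
      (λ h → let h₁ = ∧-projˡ {Up ρ₁ w} h ; h₂ = ∧-projʳ {Up ρ₁ w} h ; w⊑τ = ∧-projʳ {ρ₁ ⊑ w} h₁ in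
             ∧-intro {ρ₁₂ ⊑ w} (join w w⊑τ (∧-projˡ {ρ₁ ⊑ w} h₁) (∧-projˡ {ρ₂ ⊑ w} h₂)) w⊑τ)

    not-at-σ : ∀ w ρ → length σ < length ρ → listEqB w σ ≡ true → Up ρ w ≡ false
    not-at-σ w ρ σ<ρ e with Up ρ w in h
    ... | false = refl
    ... | true  = ⊥-elim (<-irrefl refl (<-≤-trans σ<ρ (subst (λ q → length ρ ≤ length q) (listEqB-sound {w} {σ} e)
                                                              (contains-length ρ w (∧-projˡ {ρ ⊑ w} h)))))

  -- Under a two-cover, inclusion–exclusion of the interval sums of μ↑ over [σ, τ],
  -- [ρ₁, τ], [ρ₂, τ], [ρ₁₂, τ] (all zero) leaves μ↑(σ) = 0.
  μ↑-vanishes : ∀ σ ρ₁ ρ₂ ρ₁₂ → TwoCover σ ρ₁ ρ₂ ρ₁₂ → μ↑ σ ≡ 0ℤ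
  μ↑-vanishes σ ρ₁ ρ₂ ρ₁₂ C = begin
      μ↑ σ                                  ≡⟨ sym (trans (cong₂ (λ p q → (μ↑ σ +ᶻ p) +ᶻ q) (I-zero ρ₁ proper-ρ₁) (I-zero ρ₂ proper-ρ₂))
                                                          (trans (ℤ.+-identityʳ _) (ℤ.+-identityʳ _))) ⟩
      (μ↑ σ +ᶻ I ρ₁) +ᶻ I ρ₂                ≡⟨ cong (λ S → (S +ᶻ I ρ₁) +ᶻ I ρ₂) (sym (∑-count-1 σ U μ↑ (count-permsUpTo n σ σ-perm σ-length))) ⟩
      (∑ U atσ +ᶻ I ρ₁) +ᶻ I ρ₂             ≡⟨ cong (_+ᶻ I ρ₂) (sym (∑-+ U atσ (f ρ₁))) ⟩
      ∑ U (λ w → atσ w +ᶻ f ρ₁ w) +ᶻ I ρ₂   ≡⟨ sym (∑-+ U (λ w → atσ w +ᶻ f ρ₁ w) (f ρ₂)) ⟩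
      ∑ U (λ w → (atσ w +ᶻ f ρ₁ w) +ᶻ f ρ₂ w) ≡⟨ sym (∑-cong U _ _ pointwise) ⟩
      ∑ U (λ w → f σ w +ᶻ f ρ₁₂ w)          ≡⟨ ∑-+ U (f σ) (f ρ₁₂) ⟩
      I σ +ᶻ I ρ₁₂                          ≡⟨ cong₂ _+ᶻ_ (I-zero σ proper-σ) (I-zero ρ₁₂ proper-ρ₁₂) ⟩
      0ℤ ∎
    where
    open ≡-Reasoning
    open TwoCover C
    open TwoCoverFacts C
    σ-perm = proper-perm proper-σ
    σ-length = contains-length σ τ (proper-below proper-σ)
    f : Perm → Perm → ℤ
    f x w = when (Up x w) (μ↑ w)
    atσ : Perm → ℤ
    atσ w = when (listEqB w σ) (μ↑ w)
    I : Perm → ℤ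
    I x = ∑ U (f x)
    I-zero : ∀ x → Proper x → I x ≡ 0ℤ
    I-zero = μ↑-proper-sum
    pointwise : ∀ {w} → w ∈ U → f σ w +ᶻ f ρ₁₂ w ≡ (atσ w +ᶻ f ρ₁ w) +ᶻ f ρ₂ w
    pointwise {w} m rewrite union w (U-perm m) | intersection w =
      inclusion-exclusion (listEqB w σ) (Up ρ₁ w) (Up ρ₂ w) (μ↑ w) (not-at-σ w ρ₁ σ<ρ₁) (not-at-σ w ρ₂ σ<ρ₂)

-- Quasi-consecutive position lists of length ≥ 2 are exactly the lists
--   qpos h p M = h, p, p+1, …, p+M-1,
-- a head h followed by a block of M consecutive positions starting at p.

qpos : ℕ → ℕ → ℕ → List ℕ
qpos h p M = h ∷ interval p M

consecutive-interval : ∀ a r → Consecutive (a ∷ r) → a ∷ r ≡ interval a (suc (length r))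
consecutive-interval a []      c = refl
consecutive-interval a (b ∷ r) c with c zero (s≤s (s≤s z≤n))
... | refl = cong (a ∷_) (consecutive-interval (suc a) r (λ t h → c (suc t) (s<s h)))

qpos-view : ∀ K → QuasiConsecutive K → 2 ≤ length K → K ≡ qpos (at K 0) (at K 1) (pred (length K))
qpos-view (k ∷ c ∷ r) q _ = cong (k ∷_) (consecutive-interval c r q)
qpos-view (k ∷ [])    q (s≤s ())

qpos-length : ∀ h p M → length (qpos h p M) ≡ suc M
qpos-length h p M = cong suc (length-interval p M)

qpos-increasing : ∀ h p M → h < p → Increasing (qpos h p M)
qpos-increasing h p (suc M) h<p zero _   = h<p
qpos-increasing h p zero    h<p zero (s≤s ())
qpos-increasing h p M       h<p (suc t) lt = interval-increasing p M t (s≤s⁻¹ lt)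

qpos-quasi : ∀ h p M → QuasiConsecutive (qpos h p M)
qpos-quasi h p M = interval-consecutive p M

qpos-bounded : ∀ h p M B → h < B → p + M ≤ B → Bounded (qpos h p M) B
qpos-bounded h p M B h<B pM zero    _        = h<B
qpos-bounded h p M B h<B pM (suc t) (s<s lt) =
  subst (_< B) (sym (at-interval p M t t<M)) (≤-trans (subst (_≤ p + M) (+-suc p t) (+-monoʳ-≤ p t<M)) pM)
  where
  t<M : t < M
  t<M = subst (t <_) (length-interval p M) lt

interval-select : ∀ j a L c M → c + M ≤ L → map (at (qpos j a L)) (interval (suc c) M) ≡ interval (a + c) M
interval-select j a L c zero    _ = refl
interval-select j a L c (suc M) h =
  cong₂ _∷_ (at-interval a L c (≤-trans (s≤s (m≤m+n c M)) h'))
            (trans (interval-select j a L (suc c) M h') (cong (λ q → interval q M) (+-suc a c)))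
  where
  h' = subst (_≤ L) (+-suc c M) h

qpos-select : ∀ j a L k c M → c + M ≤ L → map (at (qpos j a L)) (qpos k (suc c) M) ≡ qpos (at (qpos j a L) k) (a + c) M
qpos-select j a L k c M h = cong (at (qpos j a L) k ∷_) (interval-select j a L c M h)

record Fits (h p M j a L : ℕ) : Set where
  constructor mkFits
  field
    fits-head  : h ≡ j ⊎ a ≤ h
    fits-start : a ≤ p
    fits-end   : p + M ≤ a + L
open Fits public

selection-fits : ∀ j a L k c M h p → 0 < M → k < c → c + M ≤ suc L →
                 map (at (qpos j a L)) (qpos k c M) ≡ qpos h p M → Fits h p M j a L
selection-fits j a L k (suc c) M h p M>0 k<c cM e =
  mkFits (head k k<c (cong headOf e')) (subst (a ≤_) a+c≡p (m≤m+n a c))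
         (subst (λ q → q + M ≤ a + L) a+c≡p (subst (_≤ a + L) (sym (+-assoc a c M)) (+-monoʳ-≤ a (s≤s⁻¹ cM))))
  where
  e' = trans (sym (qpos-select j a L k c M (s≤s⁻¹ cM))) e
  headOf : List ℕ → ℕ
  headOf []      = 0
  headOf (x ∷ _) = x
  tailOf : List ℕ → List ℕ
  tailOf []      = []
  tailOf (_ ∷ r) = r
  a+c≡p : a + c ≡ p
  a+c≡p = interval-injective (a + c) p M M>0 (cong tailOf e')
  head : ∀ k → k < suc c → at (qpos j a L) k ≡ h → h ≡ j ⊎ a ≤ h
  head zero     _        e = inj₁ (sym e)
  head (suc k') (s≤s lt) e =
    inj₂ (subst (a ≤_) (trans (sym (at-interval a L k' (<-≤-trans lt (≤-trans (m≤m+n c M) (s≤s⁻¹ cM))))) e) (m≤m+n a k'))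

fits-contains : ∀ w τ j a L → Occurrence w τ (qpos j a L) → ∀ h p M → 0 < M → h < p → Fits h p M j a L →
                ∀ ρ → OrderIso ρ (map (at τ) (qpos h p M)) → length ρ ≡ suc M → containsB ρ w ≡ true
fits-contains w τ j a L oJ h p M M>0 h<p (mkFits hd ap pM) ρ iso lρ =
  containsB-complete ρ w K
    (occurrence-pullback ρ w τ (qpos j a L) K oJ (trans (qpos-length kh (suc c) M) (sym lρ))
       (qpos-increasing kh (suc c) M kh<) (qpos-quasi kh (suc c) M) bounded
       (subst (λ X → OrderIso ρ (map (at τ) X)) (sym selects) iso))
  where
  c = p ∸ a
  a+c≡p : a + c ≡ p
  a+c≡p = m+[n∸m]≡n ap
  cM≤L : c + M ≤ L
  cM≤L = +-cancelˡ-≤ a (c + M) L (subst (_≤ a + L) (trans (cong (_+ M) (sym a+c≡p)) (+-assoc a c M)) pM)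
  c<L : c < L
  c<L = ≤-trans (subst (_≤ c + M) (+-comm c 1) (+-monoʳ-≤ c M>0)) cM≤L
  headIndex : h ≡ j ⊎ a ≤ h → Σ ℕ (λ k → k < suc c × at (qpos j a L) k ≡ h)
  headIndex (inj₁ e)  = 0 , s≤s z≤n , sym e
  headIndex (inj₂ ah) = suc (h ∸ a) , s≤s (∸-monoˡ-< h<p ah)
                      , trans (at-interval a L (h ∸ a) (<-trans (∸-monoˡ-< h<p ah) c<L)) (m+[n∸m]≡n ah)
  kh = proj₁ (headIndex hd)
  kh< = proj₁ (proj₂ (headIndex hd))
  K = qpos kh (suc c) M
  selects : map (at (qpos j a L)) K ≡ qpos h p M
  selects = trans (qpos-select j a L kh c M cM≤L) (cong₂ (λ x y → qpos x y M) (proj₂ (proj₂ (headIndex hd))) a+c≡p)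
  bounded : Bounded K (length (qpos j a L))
  bounded = subst (Bounded K) (sym (qpos-length j a L))
                  (qpos-bounded kh (suc c) M (suc L) (<-≤-trans kh< (s≤s (<⇒≤ c<L))) (s≤s cM≤L))

record Enclosing (J : List ℕ) (h p M : ℕ) : Set where
  field
    shape : J ≡ qpos (at J 0) (at J 1) (pred (length J))
    fits  : Fits h p M (at J 0) (at J 1) (pred (length J))
open Enclosing public

enclosing : ∀ x w τ J K h p M → Occurrence w τ J → Occurrence x w K → length x ≡ suc M → 0 < M →
            map (at J) K ≡ qpos h p M → Enclosing J h p M
enclosing x w τ J K h p M oJ oK lx M>0 e = record
  { shape = J≡
  ; fits  = selection-fits (at J 0) (at J 1) (pred (length J)) (at K 0) (at K 1) M h p M>0
              (occ-increasing oK 0 K≥2) end (trans (cong₂ (λ X Y → map (at X) Y) (sym J≡) (sym K≡)) e) }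
  where
  lK : length K ≡ suc M
  lK = trans (occ-length oK) lx
  K≥2 : 2 ≤ length K
  K≥2 = subst (2 ≤_) (sym lK) (s≤s M>0)
  J≥2 : 2 ≤ length J
  J≥2 = subst (2 ≤_) (sym (occ-length oJ)) (≤-trans (s≤s M>0) (subst (_≤ length w) lx (occurrence-length x w K oK)))
  J≡ : J ≡ qpos (at J 0) (at J 1) (pred (length J))
  J≡ = qpos-view J (occ-quasi oJ) J≥2
  K≡ : K ≡ qpos (at K 0) (at K 1) M
  K≡ = trans (qpos-view K (occ-quasi oK) K≥2) (cong (λ q → qpos (at K 0) (at K 1) (pred q)) lK)
  -- the last position of K lies in w, so the block of K ends within J's block
  end : at K 1 + M ≤ suc (pred (length J))
  end = last-in-block (at K 1) M M>0 (subst (λ X → at X M < suc (pred (length J))) K≡ lastK)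
    where
    lastK : at K M < suc (pred (length J))
    lastK = subst (at K M <_) (trans (sym (occ-length oJ)) (trans (cong length J≡) (qpos-length (at J 0) (at J 1) (pred (length J)))))
                  (occ-bounded oK M (subst (M <_) (sym lK) ≤-refl))
    last-in-block : ∀ {k} c M {B} → 0 < M → at (qpos k c M) M < B → c + M ≤ B
    last-in-block c (suc M) {B} _ lt = subst (_≤ B) (sym (+-suc c M)) (subst (_< B) (at-interval c (suc M) M ≤-refl) lt)

selection-distinct : ∀ τ K → isPermB τ ≡ true → Increasing K → Bounded K (length τ) → Distinct (map (at τ) K)
selection-distinct τ K hτ fK bK s t hs ht e = increasing-injective K fK s t hs' ht'
  (proj₂ (isPermB-sound τ hτ) _ _ (bK s hs') (bK t ht') (trans (sym (at-map (at τ) K s hs')) (trans e (at-map (at τ) K t ht'))))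
  where
  hs' = subst (s <_) (length-map (at τ) K) hs
  ht' = subst (t <_) (length-map (at τ) K) ht

-- It is
-- kept abstract: only the properties below are ever needed, and unfolding the
-- standardisation inside the boolean pattern order would make type checking expensive.
abstract
  patternAt : List ℕ → List ℕ → List ℕ
  patternAt τ K = standardise (map (at τ) K)

  patternAt-length : ∀ τ K → length (patternAt τ K) ≡ length K
  patternAt-length τ K = trans (length-map _ (map (at τ) K)) (length-map (at τ) K)

  patternAt-iso : ∀ τ K → OrderIso (patternAt τ K) (map (at τ) K)
  patternAt-iso τ K = OrderIso-sym (standardise-iso (map (at τ) K))

  patternAt-perm : ∀ τ K → isPermB τ ≡ true → Increasing K → Bounded K (length τ) → isPermB (patternAt τ K) ≡ true
  patternAt-perm τ K hτ fK bK = standardise-perm (map (at τ) K) (selection-distinct τ K hτ fK bK)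

patternAt-occurrence : ∀ τ K → Increasing K → Bounded K (length τ) → QuasiConsecutive K → Occurrence (patternAt τ K) τ K
patternAt-occurrence τ K fK bK qK = mkOcc (sym (patternAt-length τ K)) fK bK qK (patternAt-iso τ K)

-- The extensions of this
-- occurrence by one position on the left, on the right, and on both sides of the
-- block give the patterns ρ₁, ρ₂, ρ₁₂; they form a two-cover of (σ, τ].
module TheCover (σ τ : Perm) (hσ : isPermB σ ≡ true) (hτ : isPermB τ ≡ true) (i c M : ℕ)
                (occ : Occurrence σ τ (qpos i (suc c) M))
                (unique : ∀ K → Occurrence σ τ K → K ≡ qpos i (suc c) M)
                (M>0 : 0 < M) (i>0 : 0 < i) (i<c : i < c) (room : suc c + M < length τ) where

  open Interval τ hτ

  left right both : List ℕ
  left  = qpos i c (suc M)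
  right = qpos i (suc c) (suc M)
  both  = qpos i c (suc (suc M))

  ρ₁ ρ₂ ρ₁₂ : Perm
  ρ₁  = patternAt τ left
  ρ₂  = patternAt τ right
  ρ₁₂ = patternAt τ both

  end-shift : c + suc M ≡ suc c + M
  end-shift = +-suc c M

  i<n : i < n
  i<n = <-trans (<-trans i<c (n<1+n c)) (≤-<-trans (m≤m+n (suc c) M) room)

  extension-occurrence : ∀ p L → i < p → p + L ≤ n → Occurrence (patternAt τ (qpos i p L)) τ (qpos i p L)
  extension-occurrence p L i<p pL =
    patternAt-occurrence τ (qpos i p L) (qpos-increasing i p L i<p) (qpos-bounded i p L n i<n pL) (qpos-quasi i p L)

  occ₁ : Occurrence ρ₁ τ left
  occ₁ = extension-occurrence c (suc M) i<c (subst (_≤ n) (sym end-shift) (<⇒≤ room))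
  occ₂ : Occurrence ρ₂ τ right
  occ₂ = extension-occurrence (suc c) (suc M) (<-trans i<c (n<1+n c)) (subst (_≤ n) (sym (+-suc (suc c) M)) room)
  occ₁₂ : Occurrence ρ₁₂ τ both
  occ₁₂ = extension-occurrence c (suc (suc M)) i<c (subst (_≤ n) (sym (trans (+-suc c (suc M)) (cong suc end-shift))) room)

  extension-length : ∀ p L → length (patternAt τ (qpos i p L)) ≡ suc L
  extension-length p L = trans (patternAt-length τ (qpos i p L)) (qpos-length i p L)

  σ-length : length σ ≡ suc M
  σ-length = trans (sym (occ-length occ)) (qpos-length i (suc c) M)

  σ⊑ρ₁ : σ ⊑ ρ₁ ≡ true
  σ⊑ρ₁ = fits-contains ρ₁ τ i c (suc M) occ₁ i (suc c) M M>0 (<-trans i<c (n<1+n c))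
           (mkFits (inj₁ refl) (n≤1+n c) (subst (_≤ c + suc M) end-shift ≤-refl)) σ (occ-iso occ) σ-length

  σ⊑ρ₂ : σ ⊑ ρ₂ ≡ true
  σ⊑ρ₂ = fits-contains ρ₂ τ i (suc c) (suc M) occ₂ i (suc c) M M>0 (<-trans i<c (n<1+n c))
           (mkFits (inj₁ refl) ≤-refl (+-monoʳ-≤ (suc c) (n≤1+n M))) σ (occ-iso occ) σ-length

  ρ₁⊑ρ₁₂ : ρ₁ ⊑ ρ₁₂ ≡ true
  ρ₁⊑ρ₁₂ = fits-contains ρ₁₂ τ i c (suc (suc M)) occ₁₂ i c (suc M) (s≤s z≤n) i<c
             (mkFits (inj₁ refl) ≤-refl (+-monoʳ-≤ c (n≤1+n (suc M)))) ρ₁ (patternAt-iso τ left) (extension-length c (suc M))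

  ρ₂⊑ρ₁₂ : ρ₂ ⊑ ρ₁₂ ≡ true
  ρ₂⊑ρ₁₂ = fits-contains ρ₁₂ τ i c (suc (suc M)) occ₁₂ i (suc c) (suc M) (s≤s z≤n) (<-trans i<c (n<1+n c))
             (mkFits (inj₁ refl) (n≤1+n c) (subst (_≤ c + suc (suc M)) (+-suc c (suc M)) ≤-refl))
             ρ₂ (patternAt-iso τ right) (extension-length (suc c) (suc M))

  -- all four patterns are shorter than τ: |ρ₁₂| = M+3 ≤ c+M+1 < |τ| as c ≥ 2
  ρ₁₂-short : suc (suc (suc M)) < n
  ρ₁₂-short = ≤-<-trans (s≤s (+-monoˡ-≤ M (≤-trans (s≤s i>0) i<c))) room

  proper : ∀ x K → isPermB x ≡ true → Occurrence x τ K → length x < n → Proper x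
  proper x K hx oK short = record
    { proper-perm  = hx
    ; proper-below = containsB-complete x τ K oK
    ; proper-≢     = listEqB-false-complete {x} {τ} (λ e → <-irrefl (cong length e) short) }

  proper-extension : ∀ p L → Occurrence (patternAt τ (qpos i p L)) τ (qpos i p L) → L ≤ suc (suc M) →
                     Proper (patternAt τ (qpos i p L))
  proper-extension p L oX L≤ =
    proper _ _ (patternAt-perm τ (qpos i p L) hτ (occ-increasing oX) (occ-bounded oX)) oX
           (subst (_< n) (sym (extension-length p L)) (≤-<-trans (s≤s L≤) ρ₁₂-short))

  proper-σ : Proper σ
  proper-σ = proper σ _ hσ occ (subst (_< n) (sym σ-length) (<-trans (s≤s (n≤1+n (suc M))) ρ₁₂-short))

  -- through any occurrence K of σ in w ⊑ τ (via an occurrence J of w), σ lands on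
  -- its unique occurrence, so J encloses qpos i (c+1) M
  σ-enclosed : ∀ w J K → Occurrence w τ J → Occurrence σ w K → Enclosing J i (suc c) M
  σ-enclosed w J K oJ oK = enclosing σ w τ J K i (suc c) M oJ oK σ-length M>0 (unique _ (occurrence-∘ σ w τ K J oK oJ))

  module _ (X : List ℕ) (lX : length X ≡ suc (suc M)) (E : Enclosing X i (suc c) M) where

    private
      width : pred (length X) ≡ suc M
      width = cong pred lX

    -- the block of X starts at c or c+1 …
    block-≥ : c ≤ at X 1
    block-≥ = +-cancelʳ-≤ M c (at X 1) (s≤s⁻¹ (subst (suc c + M ≤_) (+-suc (at X 1) M)
                                                    (subst (λ L → suc c + M ≤ at X 1 + L) width (fits-end (fits E)))))

    -- … so it lies beyond i, and the head of X is i
    head-i : at X 0 ≡ i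
    head-i with fits-head (fits E)
    ... | inj₁ i≡ = sym i≡
    ... | inj₂ block≤i = ⊥-elim (<-irrefl refl (<-≤-trans i<c (≤-trans block-≥ block≤i)))

    extension-form : X ≡ qpos i (at X 1) (suc M)
    extension-form = trans (shape E) (cong₂ (λ h L → qpos h (at X 1) L) head-i width)

    left-or-right : X ≡ left ⊎ X ≡ right
    left-or-right with m≤n⇒m<n∨m≡n (fits-start (fits E))
    ... | inj₁ block<c+1 = inj₁ (trans extension-form (cong (λ a → qpos i a (suc M)) (≤-antisym (s≤s⁻¹ block<c+1) block-≥)))
    ... | inj₂ block≡c+1 = inj₂ (trans extension-form (cong (λ a → qpos i a (suc M)) block≡c+1))

  extension-shape : ∀ ρ X → Occurrence ρ τ X → length ρ ≡ suc (suc M) → σ ⊑ ρ ≡ true → X ≡ left ⊎ X ≡ right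
  extension-shape ρ X oX lρ σ⊑ρ with containsB-sound σ ρ σ⊑ρ
  ... | K , oK = left-or-right X (trans (occ-length oX) lρ) (σ-enclosed ρ X K oX oK)

  -- Every w with σ < w ≤ τ contains ρ₁ or ρ₂: an occurrence J of w encloses σ's
  -- occurrence; if J's block starts before c+1 it also encloses `left`, otherwise
  -- it starts at c+1 and, w being longer than σ, is wide enough to enclose `right`.
  cover : ∀ w → isPermB w ≡ true → σ ⊑ w ≡ true → w ⊑ τ ≡ true → listEqB w σ ≡ false → ρ₁ ⊑ w ≡ true ⊎ ρ₂ ⊑ w ≡ true
  cover w hw σ⊑w w⊑τ w≢σ with containsB-sound w τ w⊑τ | containsB-sound σ w σ⊑w
  ... | J , oJ | K , oK with σ-enclosed w J K oJ oK
  ...   | E@(record { fits = mkFits hd start end }) with m≤n⇒m<n∨m≡n start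
  ...     | inj₁ block≤c = inj₁ (fits-contains w τ _ _ _ (subst (Occurrence w τ) (shape E) oJ) i c (suc M) (s≤s z≤n) i<c
                                   (mkFits hd (s≤s⁻¹ block≤c) (subst (_≤ at J 1 + pred (length J)) (sym end-shift) end)) ρ₁ (patternAt-iso τ left) (extension-length c (suc M)))
  ...     | inj₂ block≡c+1 = inj₂ (fits-contains w τ _ _ _ (subst (Occurrence w τ) (shape E) oJ) i (suc c) (suc M) (s≤s z≤n)
                                     (<-trans i<c (n<1+n c)) (mkFits hd start wide) ρ₂ (patternAt-iso τ right) (extension-length (suc c) (suc M)))
    where
    σ<w : length σ < length w
    σ<w = strictly-shorter σ w hσ hw σ⊑w (listEqB-false-complete {σ} {w} (λ e → listEqB-false-sound {w} {σ} w≢σ (sym e)))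
    -- |σ| < |w| = |J|, so the block of J has width at least M+1
    wide : suc c + suc M ≤ at J 1 + pred (length J)
    wide = subst (λ a → suc c + suc M ≤ a + pred (length J)) (sym block≡c+1)
             (+-monoʳ-≤ (suc c) (pred-mono-≤ (subst₂ _≤_ (cong suc σ-length) (sym (occ-length oJ)) σ<w)))

  proper-ρ₁ : Proper ρ₁
  proper-ρ₁ = proper-extension c (suc M) occ₁ (n≤1+n _)
  proper-ρ₂ : Proper ρ₂
  proper-ρ₂ = proper-extension (suc c) (suc M) occ₂ (n≤1+n _)
  proper-ρ₁₂ : Proper ρ₁₂
  proper-ρ₁₂ = proper-extension c (suc (suc M)) occ₁₂ ≤-refl

  same-positions : ∀ ρ ρ' X → isPermB ρ ≡ true → isPermB ρ' ≡ true →
                   OrderIso ρ (map (at τ) X) → OrderIso ρ' (map (at τ) X) → ρ ≡ ρ'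
  same-positions ρ ρ' X hρ hρ' iso iso' = perm-iso-≡ ρ ρ' hρ hρ' (OrderIso-trans iso (OrderIso-sym iso'))

  -- If ρ₁ ≠ ρ₂, any w ≤ τ above both contains ρ₁₂: through an occurrence J of w the
  -- patterns ρ₁ and ρ₂ must land on `left` and `right` respectively (landing on the
  -- other extension would make them equal), so J encloses both and hence `both`.
  join : listEqB ρ₁ ρ₂ ≡ false → ∀ w → w ⊑ τ ≡ true → ρ₁ ⊑ w ≡ true → ρ₂ ⊑ w ≡ true → ρ₁₂ ⊑ w ≡ true
  join ρ₁≢ρ₂ w w⊑τ ρ₁⊑w ρ₂⊑w = through (containsB-sound w τ w⊑τ) (containsB-sound ρ₁ w ρ₁⊑w) (containsB-sound ρ₂ w ρ₂⊑w)
    where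
    ρ₁≠ρ₂ : ρ₁ ≢ ρ₂
    ρ₁≠ρ₂ = listEqB-false-sound ρ₁≢ρ₂
    through : ∃[ J ] Occurrence w τ J → ∃[ K ] Occurrence ρ₁ w K → ∃[ K ] Occurrence ρ₂ w K → ρ₁₂ ⊑ w ≡ true
    through (J , oJ) (K₁ , oK₁) (K₂ , oK₂) =
      fits-contains w τ _ _ _ (subst (Occurrence w τ) (shape E₁) oJ) i c (suc (suc M)) (s≤s z≤n) i<c
        (mkFits (fits-head (fits E₁)) (fits-start (fits E₁))
                (subst (_≤ at J 1 + pred (length J)) (sym (+-suc c (suc M))) (fits-end (fits E₂))))
        ρ₁₂ (patternAt-iso τ both) (extension-length c (suc (suc M)))
      where
      o₁ = occurrence-∘ ρ₁ w τ K₁ J oK₁ oJ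
      o₂ = occurrence-∘ ρ₂ w τ K₂ J oK₂ oJ
      lands-left : map (at J) K₁ ≡ left
      lands-left = [ id , (λ e → ⊥-elim (ρ₁≠ρ₂ (same-positions ρ₁ ρ₂ right (proper-perm proper-ρ₁) (proper-perm proper-ρ₂)
                                    (subst (λ X → OrderIso ρ₁ (map (at τ) X)) e (occ-iso o₁)) (patternAt-iso τ right)))) ]′
                   (extension-shape ρ₁ _ o₁ (extension-length c (suc M)) σ⊑ρ₁)
      lands-right : map (at J) K₂ ≡ right
      lands-right = [ (λ e → ⊥-elim (ρ₁≠ρ₂ (same-positions ρ₁ ρ₂ left (proper-perm proper-ρ₁) (proper-perm proper-ρ₂)
                                    (patternAt-iso τ left) (subst (λ X → OrderIso ρ₂ (map (at τ) X)) e (occ-iso o₂))))) , id ]′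
                   (extension-shape ρ₂ _ o₂ (extension-length (suc c) (suc M)) σ⊑ρ₂)
      E₁ = enclosing ρ₁ w τ J K₁ i c (suc M) oJ oK₁ (extension-length c (suc M)) (s≤s z≤n) lands-left
      E₂ = enclosing ρ₂ w τ J K₂ i (suc c) (suc M) oJ oK₂ (extension-length (suc c) (suc M)) (s≤s z≤n) lands-right

  σ<ρ : ∀ p → length σ < length (patternAt τ (qpos i p (suc M)))
  σ<ρ p = subst₂ _<_ (sym σ-length) (sym (extension-length p (suc M))) ≤-refl

  μ↑-σ : μ↑ σ ≡ 0ℤ
  μ↑-σ with bool-cases (listEqB ρ₁ ρ₂)
  ... | inj₂ ρ₁≢ρ₂ = μ↑-vanishes σ ρ₁ ρ₂ ρ₁₂ record
    { proper-σ = proper-σ ; proper-ρ₁ = proper-ρ₁ ; proper-ρ₂ = proper-ρ₂ ; proper-ρ₁₂ = proper-ρ₁₂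
    ; σ⊑ρ₁ = σ⊑ρ₁ ; σ⊑ρ₂ = σ⊑ρ₂ ; σ<ρ₁ = σ<ρ c ; σ<ρ₂ = σ<ρ (suc c)
    ; ρ₁⊑ρ₁₂ = ρ₁⊑ρ₁₂ ; ρ₂⊑ρ₁₂ = ρ₂⊑ρ₁₂ ; cover = cover ; join = join ρ₁≢ρ₂ }
  -- if the two extensions coincide, (σ, τ] is the up-set of ρ₁ alone
  ... | inj₁ ρ₁≡ρ₂ = μ↑-vanishes σ ρ₁ ρ₁ ρ₁ record
    { proper-σ = proper-σ ; proper-ρ₁ = proper-ρ₁ ; proper-ρ₂ = proper-ρ₁ ; proper-ρ₁₂ = proper-ρ₁
    ; σ⊑ρ₁ = σ⊑ρ₁ ; σ⊑ρ₂ = σ⊑ρ₁ ; σ<ρ₁ = σ<ρ c ; σ<ρ₂ = σ<ρ c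
    ; ρ₁⊑ρ₁₂ = contains-refl ρ₁ ; ρ₂⊑ρ₁₂ = contains-refl ρ₁ ; cover = cover₁ ; join = λ _ _ h _ → h }
    where
    cover₁ : ∀ w → isPermB w ≡ true → σ ⊑ w ≡ true → w ⊑ τ ≡ true → listEqB w σ ≡ false → ρ₁ ⊑ w ≡ true ⊎ ρ₁ ⊑ w ≡ true
    cover₁ w hw σ⊑w w⊑τ w≢σ with cover w hw σ⊑w w⊑τ w≢σ
    ... | inj₁ h = inj₁ h
    ... | inj₂ h = inj₂ (subst (λ ρ → ρ ⊑ w ≡ true) (sym (listEqB-sound {ρ₁} {ρ₂} ρ₁≡ρ₂)) h)

  μ-σ-τ : μ σ τ ≡ 0ℤ
  μ-σ-τ = trans (μ≡μ↑ σ hσ (proper-below proper-σ)) μ↑-σ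

T⇒≡ : ∀ {b} → T b → b ≡ true
T⇒≡ = Equivalence.to T-≡

positive : ∀ {k l} → 0 ∉ k ∷ l → 0 < k
positive {zero}  0∉ = ⊥-elim (0∉ (here refl))
positive {suc k} _  = s≤s z≤n

occurrence-qpos : ∀ {σ τ} i c r → Occurrence σ τ (i ∷ suc c ∷ r) → i ∷ suc c ∷ r ≡ qpos i (suc c) (suc (length r))
occurrence-qpos i c r o = cong (i ∷_) (consecutive-interval (suc c) r (occ-quasi o))

-- the positions increase and i+1 is skipped, so i < c
skipped-gap : ∀ {σ τ} i c r → Occurrence σ τ (i ∷ suc c ∷ r) → T (not (suc c ≡ᵇ suc i)) → i < c
skipped-gap i c r o gap =
  ≤∧≢⇒< (s≤s⁻¹ (occ-increasing o 0 (s<s (s<s z≤n)))) (λ i≡c → subst (λ b → T (not b)) (≡ᵇ-complete (cong suc (sym i≡c))) gap)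

-- the last position c+1+|r| is not the final position of τ, so c+1+|r|+1 < |τ|
block-room : ∀ {σ τ} i c r → Occurrence σ τ (i ∷ suc c ∷ r) → (length τ ∸ 1) ∉ (i ∷ suc c ∷ r) →
             suc c + suc (length r) < length τ
block-room {τ = τ} i c r o last∉ =
  subst (_< length τ) (trans (cong suc last) (sym (+-suc (suc c) (length r))))
        (before-final (occ-bounded o M ≤-refl) (λ e → last∉ (subst (_∈ i ∷ suc c ∷ r) e (at-∈ (i ∷ suc c ∷ r) M ≤-refl))))
  where
  M = suc (length r)
  last : at (i ∷ suc c ∷ r) M ≡ suc c + length r
  last = trans (cong (λ K → at K M) (occurrence-qpos i c r o)) (at-interval (suc c) M (length r) ≤-refl)
  before-final : ∀ {x n} → x < n → x ≢ n ∸ 1 → suc x < n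
  before-final {n = suc n} (s≤s x≤n) x≢n = s≤s (≤∧≢⇒< x≤n x≢n)

proposition4p6 : (σ τ : List ℕ) → IsPerm σ → IsPerm τ
    → (is : List ℕ) → IsOcc σ τ is → ((js : List ℕ) → IsOcc σ τ js → js ≡ is)
    → NotConsecutive is
    → 0 ∉ is → 1 ∉ is → (length τ ∸ 1) ∉ is
    → μ σ τ ≡ 0ℤ
proposition4p6 σ τ hσ hτ (i ∷ zero ∷ r) occ _ _ _ _ _
  with occ-increasing (isOccB-sound σ τ (i ∷ zero ∷ r) (T⇒≡ occ)) 0 (s<s (s<s z≤n))
... | ()
proposition4p6 σ τ hσ hτ (i ∷ suc c ∷ r) occ uniq (notConsec gap) 0∉ _ last∉ =
  TheCover.μ-σ-τ σ τ (T⇒≡ hσ) (T⇒≡ hτ) i c (suc (length r)) (subst (Occurrence σ τ) is≡ o) unique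
                 (s≤s z≤n) (positive 0∉) (skipped-gap i c r o gap) (block-room i c r o last∉)
  where
  o = isOccB-sound σ τ (i ∷ suc c ∷ r) (T⇒≡ occ)
  is≡ = occurrence-qpos i c r o
  unique : ∀ K → Occurrence σ τ K → K ≡ qpos i (suc c) (suc (length r))
  unique K oK = trans (uniq K (Equivalence.from T-≡ (isOccB-complete σ τ K oK))) is≡
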